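{- Let $V$ be a complex vector space with $\dim V=k$, and let $n$ be a positive integer with $k^2<n$. Let $S_n$ act on $V^{\otimes n}$ by permuting tensor factors (no signs), giving the algebra homomorphism $\varphi:\mathbb{C}S_n\to \mathrm{End}_{\mathbb{C}}(V^{\otimes n})$, $\varphi_\sigma(v_1\otimes\cdots\otimes v_n)=v_{\sigma^{ -1}(1)}\otimes\cdots\otimes v_{\sigma^{ -1}(n)}$. Let $A_n\subseteq S_n$ be the alternating group. Then $$\varphi(\mathbb{C}A_n)=\varphi(\mathbb{C}S_n),\qquad\text{and hence}\qquad \mathrm{End}_{\mathbb{C}A_n}(V^{\otimes n})=\mathrm{End}_{\mathbb{C}S_n}(V^{\otimes n}),$$ where $\mathrm{End}_{\mathbb{C}G}(V^{\otimes n})$ denotes the algebra of linear maps $V^{\otimes n}\to V^{\otimes n}$ commuting with $\varphi_\sigma$ for all $\sigma\in G$. -}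

module Defs where

open import Level using (Level; _⊔_)
open import Algebra.Bundles using (CommutativeRing)
open import Data.Nat as ℕ using (ℕ; zero; suc)
open import Data.Nat.DivMod using (_%_)
open import Data.Fin as Fin using (Fin)
open import Data.Fin.Permutation using (Permutation′; _⟨$⟩ʳ_; _⟨$⟩ˡ_)
open import Data.Vec as Vec using (Vec; []; _∷_; tabulate; lookup)
open import Data.Vec.Properties using (≡-dec)
open import Data.List as List using (List; []; _∷_; allFin; concatMap; filter; foldr; map)
open import Data.List.Relation.Unary.All using (All)
open import Data.Product using (Σ; ∃; _×_; _,_; proj₁; proj₂)
open import Data.Unit using (⊤)
open import Relation.Nullary using (¬_; yes; no)
open import Relation.Binary.PropositionalEquality using (_≡_)
import Data.Fin.Properties as FinP

module FieldDefs {c ℓ} (F : CommutativeRing c ℓ) where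
  open CommutativeRing F

  IsField : Set (c ⊔ ℓ)
  IsField = (1# ≉ 0#) × (∀ x → x ≉ 0# → ∃ λ y → (x * y) ≈ 1#)

  _⋆1 : ℕ → Carrier
  zero ⋆1 = 0#
  suc m ⋆1 = 1# + (m ⋆1)

  CharZero : Set ℓ
  CharZero = ∀ m → ¬ (suc m ⋆1 ≈ 0#)

  -- value at x of the monic polynomial  c₀ + c₁ x + ... + c_d x^d + x^(d+1)
  -- given by the coefficient list (c₀ , ... , c_d)
  evalMonic : List Carrier → Carrier → Carrier
  evalMonic [] x = 1#
  evalMonic (a ∷ as) x = a + x * evalMonic as x

  AlgClosed : Set (c ⊔ ℓ)
  AlgClosed = ∀ (a : Carrier) (as : List Carrier) → ∃ λ x → evalMonic (a ∷ as) x ≈ 0#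

  -- algebraically closed field of characteristic zero (the first-order theory of ℂ)
  IsACF0 : Set (c ⊔ ℓ)
  IsACF0 = IsField × CharZero × AlgClosed

inversions : ∀ {n} → Permutation′ n → ℕ
inversions {n} σ = List.length
  (filter (λ ij → (σ ⟨$⟩ʳ proj₂ ij) Fin.<? (σ ⟨$⟩ʳ proj₁ ij))
    (filter (λ ij → proj₁ ij Fin.<? proj₂ ij)
      (concatMap (λ i → map (λ j → (i , j)) (allFin n)) (allFin n))))

IsEven : ∀ {n} → Permutation′ n → Set
IsEven σ = inversions σ % 2 ≡ 0

AllPerms : ∀ {n} → Permutation′ n → Set
AllPerms _ = ⊤

-- all words of length n over Fin k (the standard basis of V^{⊗n}, dim V = k)
allWords : ∀ k n → List (Vec (Fin k) n)
allWords k zero = [] ∷ []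
allWords k (suc n) = concatMap (λ a → map (a ∷_) (allWords k n)) (allFin k)

-- Linear endomorphisms of V^{⊗n} (V = F^k) as matrices w.r.t. the basis
-- e_{v₁} ⊗ ... ⊗ e_{vₙ}, indexed by words v : Vec (Fin k) n.
module Tensor {c ℓ} (F : CommutativeRing c ℓ) (k n : ℕ) where
  open CommutativeRing F

  Word : Set
  Word = Vec (Fin k) n

  Mat : Set c
  Mat = Word → Word → Carrier

  _≈ₘ_ : Mat → Mat → Set ℓ
  M ≈ₘ N = ∀ w v → M w v ≈ N w v

  Σ-list : List Carrier → Carrier
  Σ-list = foldr _+_ 0#

  _·_ : Mat → Mat → Mat
  (M · N) w v = Σ-list (map (λ u → M w u * N u v) (allWords k n))

  act : Permutation′ n → Word → Word
  act σ v = tabulate (λ i → lookup v (σ ⟨$⟩ˡ i))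

  -- φ_σ (e_v) = e_{σ·v}; matrix entry (w , v)
  φ : Permutation′ n → Mat
  φ σ w v with ≡-dec FinP._≟_ w (act σ v)
  ... | yes _ = 1#
  ... | no  _ = 0#

  lincomb : List (Carrier × Permutation′ n) → Mat
  lincomb L w v = Σ-list (map (λ p → proj₁ p * φ (proj₂ p) w v) L)

  InImage : ∀ {p} → (Permutation′ n → Set p) → Mat → Set (c ⊔ ℓ ⊔ p)
  InImage G M = Σ (List (Carrier × Permutation′ n)) λ L →
    All (λ q → G (proj₂ q)) L × (M ≈ₘ lincomb L)

  Commutes : ∀ {p} → (Permutation′ n → Set p) → Mat → Set (ℓ ⊔ p)
  Commutes G M = ∀ σ → G σ → (M · φ σ) ≈ₘ (φ σ · M)

{-# OPTIONS --safe #-}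
module Submission where

-- Work over ℤ with the positive definite form ⟨X , Y⟩ = ∑ X(w,v) Y(w,v) on matrices.  If X is
-- orthogonal to φ(Aₙ), then ∑σ sign σ ⟨φ σ , X⟩² = 0: expanding the square gives a sum over pairs of
-- words (v, v′), and as k² < n some transposition t fixes both v and v′, so σ ↦ t ∘ₚ σ pairs off the
-- terms with opposite signs.  The even terms vanish by assumption, hence so does every ⟨φ σ , X⟩, i.e.
-- X ⊥ φ(Sₙ).  Projecting φ σ integrally onto φ(Aₙ) (Gram–Schmidt with denominators cleared) leaves a
-- residual D φ σ + ∑ cτ φ τ (τ even, D ≠ 0) that lies in φ(Sₙ) and is orthogonal to φ(Aₙ), hence to
-- itself, so it is zero.  In characteristic 0 the image of D is invertible in F, which puts φ σ in the
-- span of φ(Aₙ); the equality of the commutants follows by linearity.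

open import Defs

open import Level using (Level; _⊔_)
open import Function using (_∘_; id)
open import Data.Bool using (true; false; if_then_else_)
open import Data.Nat as ℕ using (ℕ; zero; suc)
open import Data.Integer as ℤ using (ℤ; 0ℤ)
import Data.Integer.Properties as ℤP
open import Data.Sum using (_⊎_; inj₁; inj₂; [_,_]′)
open import Data.Fin as Fin using (Fin)
import Data.Fin.Properties as FinP
open import Data.Vec as Vec using (Vec; []; _∷_)
open import Data.Vec.Properties
  using (≡-dec; lookup∘tabulate; tabulate-cong; tabulate∘lookup; lookup-map; map-∘; map-cong; map-id)
open import Data.List using (List; []; _∷_; _++_; map; concatMap; filter; foldr; allFin; tabulate)
open import Data.Product using (∃; ∃₂; _×_; _,_; proj₁; proj₂)
open import Data.List.Membership.Propositional using (_∈_)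
open import Data.List.Membership.Propositional.Properties using (∈-concatMap⁺; ∈-map⁺; ∈-allFin; ∈-filter⁺)
open import Data.List.Relation.Unary.Any as Any using (here)
open import Data.List.Relation.Unary.All as All using (All; []; _∷_)
import Data.List.Relation.Unary.All.Properties as AllP
open import Data.Fin.Permutation
  using (Permutation′; _⟨$⟩ʳ_; _⟨$⟩ˡ_; permutation; inverseˡ; inverseʳ; _∘ₚ_; flip; transpose)
  renaming (_≈_ to _≈ₚ_)
import Data.Fin.Permutation.Components as PC
open import Relation.Nullary.Decidable using (_×-dec_; dec-true; dec-false)
open import Relation.Nullary using (¬_; Dec; yes; no; does; contradiction)
open import Relation.Unary using (Decidable)
open import Relation.Binary.Definitions using (DecidableEquality)
open import Relation.Binary.PropositionalEquality as ≡ using (_≡_; _≢_; ≢-sym)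
open import Algebra.Bundles using (CommutativeSemiring; CommutativeRing)

module ListSum {c ℓ} (R : CommutativeSemiring c ℓ) where
  open CommutativeSemiring R
  open import Relation.Binary.Reasoning.Setoid setoid
  open import Algebra.Properties.CommutativeSemigroup +-commutativeSemigroup using (interchange)

  private variable
    a b : Level
    A : Set a
    B : Set b

  ∑ : List A → (A → Carrier) → Carrier
  ∑ xs f = foldr _+_ 0# (map f xs)

  syntax ∑ xs (λ x → e) = ∑[ x ∈ xs ] e

  ∑-cong : ∀ (xs : List A) {f g} → (∀ x → f x ≈ g x) → ∑ xs f ≈ ∑ xs g
  ∑-cong []       f≈g = refl
  ∑-cong (x ∷ xs) f≈g = +-cong (f≈g x) (∑-cong xs f≈g)

  ∑-distrib-+ : ∀ (xs : List A) f g → ∑[ x ∈ xs ] (f x + g x) ≈ ∑ xs f + ∑ xs g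
  ∑-distrib-+ []       f g = sym (+-identityʳ 0#)
  ∑-distrib-+ (x ∷ xs) f g = trans (+-congˡ (∑-distrib-+ xs f g)) (interchange _ _ _ _)

  *-distribˡ-∑ : ∀ y (xs : List A) f → y * ∑ xs f ≈ ∑[ x ∈ xs ] (y * f x)
  *-distribˡ-∑ y []       f = zeroʳ y
  *-distribˡ-∑ y (x ∷ xs) f = trans (distribˡ y _ _) (+-congˡ (*-distribˡ-∑ y xs f))

  *-distribʳ-∑ : ∀ y (xs : List A) f → ∑ xs f * y ≈ ∑[ x ∈ xs ] (f x * y)
  *-distribʳ-∑ y xs f = trans (*-comm _ y) (trans (*-distribˡ-∑ y xs f) (∑-cong xs (λ x → *-comm y (f x))))

  ∑-*-∑ : ∀ (xs : List A) (ys : List B) f g → ∑ xs f * ∑ ys g ≈ ∑[ x ∈ xs ] ∑[ y ∈ ys ] (f x * g y)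
  ∑-*-∑ xs ys f g = trans (*-distribʳ-∑ _ xs f) (∑-cong xs (λ x → *-distribˡ-∑ (f x) ys g))

  ∑-zero : ∀ (xs : List A) → ∑[ x ∈ xs ] 0# ≈ 0#
  ∑-zero xs = begin
    ∑[ x ∈ xs ] 0#        ≈⟨ ∑-cong xs (λ _ → sym (zeroˡ 0#)) ⟩
    ∑[ x ∈ xs ] (0# * 0#) ≈⟨ *-distribˡ-∑ 0# xs _ ⟨
    0# * ∑[ x ∈ xs ] 0#   ≈⟨ zeroˡ _ ⟩
    0#                    ∎

  ∑-cong-All : ∀ {xs : List A} {f g} → All (λ x → f x ≈ g x) xs → ∑ xs f ≈ ∑ xs g
  ∑-cong-All []           = refl
  ∑-cong-All (fx≈gx ∷ eqs) = +-cong fx≈gx (∑-cong-All eqs)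

  ∑-++ : ∀ (xs ys : List A) f → ∑ (xs ++ ys) f ≈ ∑ xs f + ∑ ys f
  ∑-++ []       ys f = sym (+-identityˡ _)
  ∑-++ (x ∷ xs) ys f = trans (+-congˡ (∑-++ xs ys f)) (sym (+-assoc _ _ _))

  ∑-filter : ∀ {p} {P : A → Set p} (P? : Decidable P) (xs : List A) f →
           ∑ (filter P? xs) f ≈ ∑[ x ∈ xs ] ((if does (P? x) then 1# else 0#) * f x)
  ∑-filter P? []       f = refl
  ∑-filter P? (x ∷ xs) f with does (P? x)
  ... | true  = +-cong (sym (*-identityˡ _)) (∑-filter P? xs f)
  ... | false = trans (∑-filter P? xs f) (sym (trans (+-congʳ (zeroˡ _)) (+-identityˡ _)))

  ∑-map : ∀ (g : A → B) xs f → ∑ (map g xs) f ≈ ∑ xs (f ∘ g)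
  ∑-map g []       f = refl
  ∑-map g (x ∷ xs) f = +-congˡ (∑-map g xs f)

  ∑-concatMap : ∀ (g : A → List B) xs f → ∑ (concatMap g xs) f ≈ ∑[ x ∈ xs ] ∑ (g x) f
  ∑-concatMap g []       f = refl
  ∑-concatMap g (x ∷ xs) f = trans (∑-++ (g x) _ f) (+-congˡ (∑-concatMap g xs f))

  ∑-comm : ∀ (xs : List A) (ys : List B) (f : A → B → Carrier) →
           ∑[ x ∈ xs ] ∑ ys (f x) ≈ ∑[ y ∈ ys ] ∑[ x ∈ xs ] f x y
  ∑-comm []       ys f = sym (∑-zero ys)
  ∑-comm (x ∷ xs) ys f = trans (+-congˡ (∑-comm xs ys f)) (sym (∑-distrib-+ ys _ _))

  module Enumeration (_≟_ : DecidableEquality A) where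

    δ : A → A → Carrier
    δ x y = if does (x ≟ y) then 1# else 0#

    Enumerates : List A → Set _
    Enumerates xs = ∀ x (f : A → Carrier) → ∑[ y ∈ xs ] (δ x y * f y) ≈ f x

    δ-transport : ∀ (π π⁻ : A → A) → (∀ x → π (π⁻ x) ≡ x) → (∀ x → π⁻ (π x) ≡ x) →
                  ∀ x y → δ (π x) y ≡ δ (π⁻ y) x
    δ-transport π π⁻ ππ⁻ π⁻π x y with π x ≟ y | π⁻ y ≟ x
    ... | yes _      | yes _       = ≡.refl
    ... | no  _      | no  _       = ≡.refl
    ... | yes ≡.refl | no  π⁻πx≢x = contradiction (π⁻π x) π⁻πx≢x
    ... | no  πx≢y   | yes ≡.refl  = contradiction (ππ⁻ y) πx≢y

    δ-comm : ∀ x y → δ x y ≡ δ y x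
    δ-comm = δ-transport id id (λ _ → ≡.refl) (λ _ → ≡.refl)

    ∑-bijection : ∀ {xs} → Enumerates xs → (π π⁻ : A → A) →
                  (∀ x → π (π⁻ x) ≡ x) → (∀ x → π⁻ (π x) ≡ x) → ∀ f → ∑ xs (f ∘ π) ≈ ∑ xs f
    ∑-bijection {xs} enum π π⁻ ππ⁻ π⁻π f = begin
      ∑[ x ∈ xs ] f (π x)                         ≈⟨ ∑-cong xs (λ x → enum (π x) f) ⟨
      ∑[ x ∈ xs ] ∑[ y ∈ xs ] (δ (π x) y * f y)   ≈⟨ ∑-comm xs xs _ ⟩
      ∑[ y ∈ xs ] ∑[ x ∈ xs ] (δ (π x) y * f y)   ≈⟨ ∑-cong xs (λ y → ∑-cong xs (λ x →
                                                       reflexive (≡.cong (_* f y) (δ-transport π π⁻ ππ⁻ π⁻π x y)))) ⟩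
      ∑[ y ∈ xs ] ∑[ x ∈ xs ] (δ (π⁻ y) x * f y)  ≈⟨ ∑-cong xs (λ y → enum (π⁻ y) (λ _ → f y)) ⟩
      ∑[ y ∈ xs ] f y                             ∎

  ∑-tabulate : ∀ {n} (g : Fin n → A) f → ∑ (tabulate g) f ≈ ∑ (allFin n) (f ∘ g)
  ∑-tabulate {n = zero}  g f = refl
  ∑-tabulate {n = suc n} g f =
    +-congˡ (trans (∑-tabulate (g ∘ Fin.suc) f) (sym (∑-tabulate Fin.suc (f ∘ g))))

  open Enumeration

  allFin-enumerates : ∀ n → Enumerates FinP._≟_ (allFin n)
  allFin-enumerates (suc n) Fin.zero f = begin
    1# * f Fin.zero + ∑ (tabulate Fin.suc) (λ y → δ FinP._≟_ Fin.zero y * f y)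
      ≈⟨ +-cong (*-identityˡ _) (∑-tabulate {n = n} Fin.suc _) ⟩
    f Fin.zero + ∑[ y ∈ allFin n ] (0# * f (Fin.suc y))
      ≈⟨ +-congˡ (trans (∑-cong (allFin n) (λ _ → zeroˡ _)) (∑-zero (allFin n))) ⟩
    f Fin.zero + 0#
      ≈⟨ +-identityʳ _ ⟩
    f Fin.zero ∎
  allFin-enumerates (suc n) (Fin.suc x) f = begin
    0# * f Fin.zero + ∑ (tabulate Fin.suc) (λ y → δ FinP._≟_ (Fin.suc x) y * f y)
      ≈⟨ +-cong (zeroˡ _) (∑-tabulate {n = n} Fin.suc _) ⟩
    0# + ∑[ y ∈ allFin n ] (δ FinP._≟_ x y * f (Fin.suc y))
      ≈⟨ +-identityˡ _ ⟩
    ∑[ y ∈ allFin n ] (δ FinP._≟_ x y * f (Fin.suc y))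
      ≈⟨ allFin-enumerates n x (f ∘ Fin.suc) ⟩
    f (Fin.suc x) ∎

  ∑-allWords-suc : ∀ k n f → ∑ (allWords k (suc n)) f ≈ ∑[ a ∈ allFin k ] ∑[ w ∈ allWords k n ] f (a ∷ w)
  ∑-allWords-suc k n f = trans (∑-concatMap _ (allFin k) f)
                               (∑-cong (allFin k) (λ a → ∑-map (a ∷_) (allWords k n) f))

  δ-∷ : ∀ {k n} (b a : Fin k) (u w : Vec (Fin k) n) →
        δ (≡-dec FinP._≟_) (b ∷ u) (a ∷ w) ≈ δ FinP._≟_ b a * δ (≡-dec FinP._≟_) u w
  δ-∷ b a u w with b FinP.≟ a
  ... | yes _ = sym (*-identityˡ _)
  ... | no  _ = sym (zeroˡ _)

  allWords-enumerates : ∀ k n → Enumerates (≡-dec FinP._≟_) (allWords k n)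
  allWords-enumerates k zero    []      f = trans (+-identityʳ _) (*-identityˡ _)
  allWords-enumerates k (suc n) (b ∷ u) f = begin
    ∑[ v ∈ allWords k (suc n) ] (δ≟ (b ∷ u) v * f v)
      ≈⟨ ∑-allWords-suc k n _ ⟩
    ∑[ a ∈ allFin k ] ∑[ w ∈ allWords k n ] (δ≟ (b ∷ u) (a ∷ w) * f (a ∷ w))
      ≈⟨ ∑-cong (allFin k) (λ a → ∑-cong (allWords k n) (λ w → trans (*-congʳ (δ-∷ b a u w)) (*-assoc _ _ _))) ⟩
    ∑[ a ∈ allFin k ] ∑[ w ∈ allWords k n ] (δ FinP._≟_ b a * (δ≟ u w * f (a ∷ w)))
      ≈⟨ ∑-cong (allFin k) (λ a → sym (*-distribˡ-∑ _ (allWords k n) _)) ⟩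
    ∑[ a ∈ allFin k ] (δ FinP._≟_ b a * ∑[ w ∈ allWords k n ] (δ≟ u w * f (a ∷ w)))
      ≈⟨ ∑-cong (allFin k) (λ a → *-congˡ (allWords-enumerates k n u (f ∘ (a ∷_)))) ⟩
    ∑[ a ∈ allFin k ] (δ FinP._≟_ b a * f (a ∷ u))
      ≈⟨ allFin-enumerates k b (λ a → f (a ∷ u)) ⟩
    f (b ∷ u) ∎
    where
    δ≟ : ∀ {m} → Vec (Fin k) m → Vec (Fin k) m → Carrier
    δ≟ = δ (≡-dec FinP._≟_)

∈-allWords : ∀ {k n} (w : Vec (Fin k) n) → w ∈ allWords k n
∈-allWords []      = here ≡.refl
∈-allWords (a ∷ w) = ∈-concatMap⁺ _ (Any.map (λ { ≡.refl → ∈-map⁺ (a ∷_) (∈-allWords w) }) (∈-allFin a))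

module _ {n : ℕ} where

  transpose-matchˡ : ∀ (i j : Fin n) → PC.transpose i j i ≡ j
  transpose-matchˡ i j rewrite dec-true (i FinP.≟ i) ≡.refl = ≡.refl

  transpose-matchʳ : ∀ (i j : Fin n) → PC.transpose i j j ≡ i
  transpose-matchʳ i j with j FinP.≟ i
  ... | yes j≡i = j≡i
  ... | no  _   rewrite dec-true (j FinP.≟ j) ≡.refl = ≡.refl

  transpose-miss : ∀ {i j k : Fin n} → k ≢ i → k ≢ j → PC.transpose i j k ≡ k
  transpose-miss {i} {j} {k} k≢i k≢j rewrite dec-false (k FinP.≟ i) k≢i | dec-false (k FinP.≟ j) k≢j = ≡.refl

  transpose-involutive : ∀ (i j k : Fin n) → PC.transpose i j (PC.transpose i j k) ≡ k
  transpose-involutive i j k = cases (k FinP.≟ i) (k FinP.≟ j)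
    where
    cases : Dec (k ≡ i) → Dec (k ≡ j) → PC.transpose i j (PC.transpose i j k) ≡ k
    cases (yes ≡.refl) _            = ≡.trans (≡.cong (PC.transpose k j) (transpose-matchˡ k j)) (transpose-matchʳ k j)
    cases (no  _)      (yes ≡.refl) = ≡.trans (≡.cong (PC.transpose i k) (transpose-matchʳ i k)) (transpose-matchˡ i k)
    cases (no  k≢i)    (no  k≢j)    =
      ≡.trans (≡.cong (PC.transpose i j) (transpose-miss k≢i k≢j)) (transpose-miss k≢i k≢j)

  ⟨$⟩ˡ-cong : ∀ {σ τ : Permutation′ n} → σ ≈ₚ τ → ∀ i → σ ⟨$⟩ˡ i ≡ τ ⟨$⟩ˡ i
  ⟨$⟩ˡ-cong {σ} {τ} σ≈τ i = begin
    σ ⟨$⟩ˡ i                     ≡⟨ ≡.cong (σ ⟨$⟩ˡ_) (inverseʳ τ) ⟨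
    σ ⟨$⟩ˡ (τ ⟨$⟩ʳ (τ ⟨$⟩ˡ i))   ≡⟨ ≡.cong (σ ⟨$⟩ˡ_) (σ≈τ (τ ⟨$⟩ˡ i)) ⟨
    σ ⟨$⟩ˡ (σ ⟨$⟩ʳ (τ ⟨$⟩ˡ i))   ≡⟨ inverseˡ σ ⟩
    τ ⟨$⟩ˡ i                     ∎
    where open ≡.≡-Reasoning

  module _ {a} {A : Set a} where

    -- Definitionally, Tensor.act σ = permute σ.
    permute : Permutation′ n → Vec A n → Vec A n
    permute σ v = Vec.tabulate (λ i → Vec.lookup v (σ ⟨$⟩ˡ i))

    permute-∘ₚ : ∀ (σ τ : Permutation′ n) v → permute (σ ∘ₚ τ) v ≡ permute τ (permute σ v)
    permute-∘ₚ σ τ v = tabulate-cong (λ i → ≡.sym (lookup∘tabulate _ (τ ⟨$⟩ˡ i)))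

    permute-flip : ∀ (σ : Permutation′ n) v → permute σ (permute (flip σ) v) ≡ v
    permute-flip σ v =
      ≡.trans (tabulate-cong (λ i → ≡.trans (lookup∘tabulate _ (σ ⟨$⟩ˡ i)) (≡.cong (Vec.lookup v) (inverseʳ σ))))
              (tabulate∘lookup v)

    permute-cong : ∀ {σ τ : Permutation′ n} → σ ≈ₚ τ → ∀ v → permute σ v ≡ permute τ v
    permute-cong {σ} {τ} σ≈τ v = tabulate-cong (λ i → ≡.cong (Vec.lookup v) (⟨$⟩ˡ-cong {σ} {τ} σ≈τ i))

    permute-transpose : ∀ {i j} v → Vec.lookup v i ≡ Vec.lookup v j → permute (transpose i j) v ≡ v
    permute-transpose {i} {j} v vᵢ≡vⱼ = ≡.trans (tabulate-cong fixes) (tabulate∘lookup v)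
      where
      fixes : ∀ k → Vec.lookup v (PC.transpose j i k) ≡ Vec.lookup v k
      fixes k = cases (k FinP.≟ j) (k FinP.≟ i)
        where
        cases : Dec (k ≡ j) → Dec (k ≡ i) → Vec.lookup v (PC.transpose j i k) ≡ Vec.lookup v k
        cases (yes ≡.refl) _            = ≡.trans (≡.cong (Vec.lookup v) (transpose-matchˡ k i)) vᵢ≡vⱼ
        cases (no  _)      (yes ≡.refl) = ≡.trans (≡.cong (Vec.lookup v) (transpose-matchʳ j k)) (≡.sym vᵢ≡vⱼ)
        cases (no  k≢j)    (no  k≢i)    = ≡.cong (Vec.lookup v) (transpose-miss k≢j k≢i)

Inverses : ∀ {n} → (Fin n → Fin n) → (Fin n → Fin n) → Set
Inverses f g = (∀ i → g (f i) ≡ i) × (∀ i → f (g i) ≡ i)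

module _ {n : ℕ} where

  Inverses-cong : ∀ {f f′ g g′ : Fin n → Fin n} → (∀ i → f i ≡ f′ i) → (∀ i → g i ≡ g′ i) →
                  Inverses f g → Inverses f′ g′
  Inverses-cong {f} {f′} {g} {g′} f≗f′ g≗g′ (gf , fg) =
      (λ i → ≡.trans (≡.sym (g≗g′ _)) (≡.trans (≡.cong g (≡.sym (f≗f′ i))) (gf i)))
    , (λ i → ≡.trans (≡.sym (f≗f′ _)) (≡.trans (≡.cong f (≡.sym (g≗g′ i))) (fg i)))

  Inverses-∘ : ∀ (t : Permutation′ n) {f g} → Inverses f g → Inverses (f ∘ (t ⟨$⟩ʳ_)) ((t ⟨$⟩ˡ_) ∘ g)
  Inverses-∘ t {f} {g} (gf , fg) =
      (λ i → ≡.trans (≡.cong (t ⟨$⟩ˡ_) (gf _)) (inverseˡ t))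
    , (λ i → ≡.trans (≡.cong f (inverseʳ t)) (fg i))

  inverses? : ∀ (w w′ : Vec (Fin n) n) → Dec (Inverses (Vec.lookup w) (Vec.lookup w′))
  inverses? w w′ = FinP.all? (λ i → Vec.lookup w′ (Vec.lookup w i) FinP.≟ i)
             ×-dec FinP.all? (λ i → Vec.lookup w (Vec.lookup w′ i) FinP.≟ i)

  fromWords : ∀ (w w′ : Vec (Fin n) n) → Inverses (Vec.lookup w) (Vec.lookup w′) → Permutation′ n
  fromWords w w′ (w′w , ww′) = permutation (Vec.lookup w) (Vec.lookup w′) ww′ w′w

  relabel : Permutation′ n → Vec (Fin n) n → Vec (Fin n) n
  relabel t = Vec.map (t ⟨$⟩ˡ_)

  relabel-flip : ∀ (t : Permutation′ n) w → relabel (flip t) (relabel t w) ≡ w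
  relabel-flip t w = ≡.trans (≡.sym (map-∘ _ _ w)) (≡.trans (map-cong (λ _ → inverseʳ t) w) (map-id w))

  Inverses-∘ₚ : ∀ t {w w′ : Vec (Fin n) n} → Inverses (Vec.lookup w) (Vec.lookup w′) →
                Inverses (Vec.lookup (permute (flip t) w)) (Vec.lookup (relabel t w′))
  Inverses-∘ₚ t {w} {w′} inv = Inverses-cong {f = Vec.lookup w ∘ (t ⟨$⟩ʳ_)} {g = (t ⟨$⟩ˡ_) ∘ Vec.lookup w′}
    (λ i → ≡.sym (lookup∘tabulate _ i)) (λ i → ≡.sym (lookup-map i _ w′))
    (Inverses-∘ t {Vec.lookup w} {Vec.lookup w′} inv)

  Inverses-∘ₚ⁻ : ∀ t {w w′ : Vec (Fin n) n} → Inverses (Vec.lookup (permute (flip t) w)) (Vec.lookup (relabel t w′)) →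
                 Inverses (Vec.lookup w) (Vec.lookup w′)
  Inverses-∘ₚ⁻ t {w} {w′} inv =
    Inverses-cong {f = Vec.lookup w ∘ (t ⟨$⟩ʳ_) ∘ (t ⟨$⟩ˡ_)} {g = (t ⟨$⟩ʳ_) ∘ (t ⟨$⟩ˡ_) ∘ Vec.lookup w′}
      (λ i → ≡.cong (Vec.lookup w) (inverseʳ t)) (λ i → inverseʳ t)
      (Inverses-∘ (flip t) {Vec.lookup w ∘ (t ⟨$⟩ʳ_)} {(t ⟨$⟩ˡ_) ∘ Vec.lookup w′}
        (Inverses-cong {f = Vec.lookup (permute (flip t) w)} {g = Vec.lookup (relabel t w′)}
          (lookup∘tabulate _) (λ i → lookup-map i _ w′) inv))

  permutationsFrom : Vec (Fin n) n → Vec (Fin n) n → List (Permutation′ n)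
  permutationsFrom w w′ with inverses? w w′
  ... | yes inv = fromWords w w′ inv ∷ []
  ... | no  _   = []

  permutationsFrom-complete : ∀ w w′ → Inverses (Vec.lookup w) (Vec.lookup w′) →
                              ∃ λ ρ → ρ ∈ permutationsFrom w w′ × ∀ i → ρ ⟨$⟩ʳ i ≡ Vec.lookup w i
  permutationsFrom-complete w w′ inv with inverses? w w′
  ... | yes inv′ = fromWords w w′ inv′ , here ≡.refl , λ _ → ≡.refl
  ... | no  ¬inv = contradiction inv ¬inv

-- Sₙ is enumerated through pairs of mutually inverse words, so each permutation occurs exactly once.
permutations : ∀ n → List (Permutation′ n)
permutations n = concatMap (λ w → concatMap (permutationsFrom w) (allWords n n)) (allWords n n)

∈-permutations : ∀ {n} {w w′ : Vec (Fin n) n} {ρ} → ρ ∈ permutationsFrom w w′ → ρ ∈ permutations n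
∈-permutations {n} {w} {w′} ρ∈ =
  ∈-concatMap⁺ (λ v → concatMap (permutationsFrom v) (allWords n n))
    (Any.map (λ { ≡.refl → ∈-concatMap⁺ (permutationsFrom w) (Any.map (λ { ≡.refl → ρ∈ }) (∈-allWords w′)) })
             (∈-allWords w))

permutations-complete : ∀ {n} (σ : Permutation′ n) → ∃ λ ρ → ρ ∈ permutations n × ρ ≈ₚ σ
permutations-complete {n} σ =
  let ρ , ρ∈ , ρ≗w = permutationsFrom-complete w w′ inv
  in  ρ , ∈-permutations ρ∈ , λ i → ≡.trans (ρ≗w i) (lookup∘tabulate _ i)
  where
  w w′ : Vec (Fin n) n
  w  = Vec.tabulate (σ ⟨$⟩ʳ_)
  w′ = Vec.tabulate (σ ⟨$⟩ˡ_)
  inv : Inverses (Vec.lookup w) (Vec.lookup w′)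
  inv = Inverses-cong (λ i → ≡.sym (lookup∘tabulate _ i)) (λ i → ≡.sym (lookup∘tabulate _ i))
                      ((λ _ → inverseˡ σ) , (λ _ → inverseʳ σ))

module PermutationSum {c ℓ} (R : CommutativeSemiring c ℓ) where
  open CommutativeSemiring R
  open ListSum R
  open import Relation.Binary.Reasoning.Setoid setoid

  module _ {n : ℕ} (t : Permutation′ n) where

    module _ (f : Permutation′ n → Carrier) (f-cong : ∀ {σ τ} → σ ≈ₚ τ → f σ ≈ f τ) where

      ∑-permutationsFrom-∘ₚ : ∀ w w′ → ∑[ σ ∈ permutationsFrom w w′ ] f (t ∘ₚ σ)
                                     ≈ ∑ (permutationsFrom (permute (flip t) w) (relabel t w′)) f
      ∑-permutationsFrom-∘ₚ w w′ with inverses? w w′ | inverses? (permute (flip t) w) (relabel t w′)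
      ... | yes _    | yes _    = +-congʳ (f-cong (λ i → ≡.sym (lookup∘tabulate _ i)))
      ... | no  _    | no  _    = refl
      ... | yes inv  | no  ¬inv = contradiction (Inverses-∘ₚ t {w} {w′} inv) ¬inv
      ... | no  ¬inv | yes inv  = contradiction (Inverses-∘ₚ⁻ t {w} {w′} inv) ¬inv

      ∑-permutations-∘ₚ : ∑[ σ ∈ permutations n ] f (t ∘ₚ σ) ≈ ∑ (permutations n) f
      ∑-permutations-∘ₚ = begin
        ∑[ σ ∈ permutations n ] f (t ∘ₚ σ)
          ≈⟨ ∑-permutations (λ σ → f (t ∘ₚ σ)) ⟩
        ∑[ w ∈ words ] ∑[ w′ ∈ words ] ∑[ σ ∈ permutationsFrom w w′ ] f (t ∘ₚ σ)
          ≈⟨ ∑-cong words (λ w → ∑-cong words (∑-permutationsFrom-∘ₚ w)) ⟩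
        ∑[ w ∈ words ] ∑[ w′ ∈ words ] ∑ (permutationsFrom (permute (flip t) w) (relabel t w′)) f
          ≈⟨ ∑-cong words (λ w → bijection (relabel t) (relabel (flip t)) (relabel-flip (flip t)) (relabel-flip t)
                                            (λ w′ → ∑ (permutationsFrom (permute (flip t) w) w′) f)) ⟩
        ∑[ w ∈ words ] ∑[ w′ ∈ words ] ∑ (permutationsFrom (permute (flip t) w) w′) f
          ≈⟨ bijection (permute (flip t)) (permute t) (permute-flip (flip t)) (permute-flip t)
                       (λ w → ∑[ w′ ∈ words ] ∑ (permutationsFrom w w′) f) ⟩
        ∑[ w ∈ words ] ∑[ w′ ∈ words ] ∑ (permutationsFrom w w′) f
          ≈⟨ ∑-permutations f ⟨
        ∑ (permutations n) f ∎
        where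
        words : List (Vec (Fin n) n)
        words = allWords n n
        bijection : ∀ (π π⁻ : Vec (Fin n) n → Vec (Fin n) n) →
                    (∀ x → π (π⁻ x) ≡ x) → (∀ x → π⁻ (π x) ≡ x) → ∀ g → ∑ words (g ∘ π) ≈ ∑ words g
        bijection = Enumeration.∑-bijection (≡-dec FinP._≟_) {words} (allWords-enumerates n n)
        ∑-permutations : ∀ g → ∑ (permutations n) g ≈ ∑[ w ∈ words ] ∑[ w′ ∈ words ] ∑ (permutationsFrom w w′) g
        ∑-permutations g = trans (∑-concatMap _ words g) (∑-cong words (λ w → ∑-concatMap _ words g))

module Parity where
  open import Data.Nat using (_+_; _*_; _%_)
  import Data.Nat.Properties as ℕP
  open import Data.List using (length)
  open import Data.Nat.Tactic.RingSolver using (solve-∀)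
  open import Data.Nat.DivMod using (%-distribˡ-+; [m+kn]%n≡m%n; m*n%n≡0; m%n<n)
  open import Relation.Binary.Definitions using (tri<; tri≈; tri>)
  open ListSum ℕP.+-*-commutativeSemiring

  private variable n : ℕ

  lt : Fin n → Fin n → ℕ
  lt i j = if does (i Fin.<? j) then 1 else 0

  ∑∑ : (Fin n → Fin n → ℕ) → ℕ
  ∑∑ {n} f = ∑[ i ∈ allFin n ] ∑[ j ∈ allFin n ] f i j

  inversions′ : (Fin n → Fin n) → ℕ
  inversions′ f = ∑∑ (λ i j → lt i j * lt (f j) (f i))

  length≡∑ : ∀ {a} {A : Set a} (xs : List A) → length xs ≡ ∑[ x ∈ xs ] 1
  length≡∑ []       = ≡.refl
  length≡∑ (x ∷ xs) = ≡.cong suc (length≡∑ xs)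

  inversions≡inversions′ : ∀ (σ : Permutation′ n) → inversions σ ≡ inversions′ (σ ⟨$⟩ʳ_)
  inversions≡inversions′ {n} σ = begin
    length (filter P? (filter Q? pairs))                     ≡⟨ length≡∑ (filter P? (filter Q? pairs)) ⟩
    ∑[ ij ∈ filter P? (filter Q? pairs) ] 1                  ≡⟨ ∑-filter P? (filter Q? pairs) _ ⟩
    ∑[ ij ∈ filter Q? pairs ] (𝟙 (P? ij) * 1)                ≡⟨ ∑-filter Q? pairs _ ⟩
    ∑[ ij ∈ pairs ] (𝟙 (Q? ij) * (𝟙 (P? ij) * 1))            ≡⟨ ∑-concatMap _ (allFin n) _ ⟩
    ∑[ i ∈ allFin n ] ∑ (map (i ,_) (allFin n)) (λ ij → 𝟙 (Q? ij) * (𝟙 (P? ij) * 1))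
      ≡⟨ ∑-cong (allFin n) (λ i → ≡.trans (∑-map (i ,_) (allFin n) _)
                                   (∑-cong (allFin n) (λ j → ≡.cong (lt i j *_) (ℕP.*-identityʳ _)))) ⟩
    inversions′ (σ ⟨$⟩ʳ_)                                           ∎
    where
    open ≡.≡-Reasoning
    pairs : List (Fin n × Fin n)
    pairs = concatMap (λ i → map (λ j → (i , j)) (allFin n)) (allFin n)
    Q? : Decidable (λ (ij : Fin n × Fin n) → proj₁ ij Fin.< proj₂ ij)
    Q? ij = proj₁ ij Fin.<? proj₂ ij
    P? : Decidable (λ (ij : Fin n × Fin n) → σ ⟨$⟩ʳ proj₂ ij Fin.< σ ⟨$⟩ʳ proj₁ ij)
    P? ij = (σ ⟨$⟩ʳ proj₂ ij) Fin.<? (σ ⟨$⟩ʳ proj₁ ij)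
    𝟙 : ∀ {p} {P : Set p} → Dec P → ℕ
    𝟙 d = if does d then 1 else 0

  δ : Fin n → Fin n → ℕ
  δ = Enumeration.δ FinP._≟_

  lt-< : ∀ {i j : Fin n} → i Fin.< j → lt i j ≡ 1
  lt-< {i = i} {j} i<j rewrite dec-true (i Fin.<? j) i<j = ≡.refl

  lt-≮ : ∀ {i j : Fin n} → ¬ i Fin.< j → lt i j ≡ 0
  lt-≮ {i = i} {j} i≮j rewrite dec-false (i Fin.<? j) i≮j = ≡.refl

  lt-irrefl : ∀ (i : Fin n) → lt i i ≡ 0
  lt-irrefl i = lt-≮ {i = i} {i} (FinP.<-irrefl ≡.refl)

  lt-idem : ∀ (i j : Fin n) → lt i j * lt i j ≡ lt i j
  lt-idem i j with does (i Fin.<? j)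
  ... | true  = ≡.refl
  ... | false = ≡.refl

  lt-trichotomy : ∀ (i j : Fin n) → lt i j + lt j i + δ i j ≡ 1
  lt-trichotomy i j with FinP.<-cmp i j
  ... | tri< i<j _ j≮i rewrite lt-< i<j | lt-≮ j≮i | dec-false (i FinP.≟ j) (FinP.<⇒≢ i<j) = ≡.refl
  ... | tri> i≮j _ j<i rewrite lt-< j<i | lt-≮ i≮j | dec-false (i FinP.≟ j) (≢-sym (FinP.<⇒≢ j<i)) = ≡.refl
  ... | tri≈ _ ≡.refl _ rewrite lt-irrefl i | dec-true (i FinP.≟ i) ≡.refl = ≡.refl

  Opposite : ℕ → ℕ → Set
  Opposite x y = (x ≡ 1 × y ≡ 0) ⊎ (x ≡ 0 × y ≡ 1)

  lt-opposite : ∀ {i j : Fin n} → i ≢ j → Opposite (lt i j) (lt j i)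
  lt-opposite {i = i} {j} i≢j with FinP.<-cmp i j
  ... | tri< i<j _ j≮i = inj₁ (lt-< i<j , lt-≮ j≮i)
  ... | tri> i≮j _ j<i = inj₂ (lt-≮ i≮j , lt-< j<i)
  ... | tri≈ _ i≡j _   = contradiction i≡j i≢j

  opposite-bits : ∀ {a a′ b b′} → Opposite a a′ → Opposite b b′ → (a + 1) * b + (a′ + 0) * b′ ≡ 2 * (a * b) + a′
  opposite-bits (inj₁ (≡.refl , ≡.refl)) (inj₁ (≡.refl , ≡.refl)) = ≡.refl
  opposite-bits (inj₁ (≡.refl , ≡.refl)) (inj₂ (≡.refl , ≡.refl)) = ≡.refl
  opposite-bits (inj₂ (≡.refl , ≡.refl)) (inj₁ (≡.refl , ≡.refl)) = ≡.refl
  opposite-bits (inj₂ (≡.refl , ≡.refl)) (inj₂ (≡.refl , ≡.refl)) = ≡.refl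

  symmetrised-summand : ∀ {p q : Fin n → Fin n} →
    (∀ {i j} → p i ≡ p j → i ≡ j) → (∀ {i j} → q i ≡ q j → i ≡ j) →
    ∀ i j → lt i j * ((lt (p i) (p j) + lt i j) * lt (q j) (q i) + (lt (p j) (p i) + lt j i) * lt (q i) (q j))
          ≡ 2 * (lt i j * (lt (p i) (p j) * lt (q j) (q i))) + lt i j * lt (p j) (p i)
  symmetrised-summand {p = p} {q} p-injective q-injective i j with i Fin.<? j
  ... | no  i≮j rewrite lt-≮ i≮j = ≡.refl
  ... | yes i<j rewrite lt-< i<j | lt-≮ (FinP.<-asym i<j) =
    ≡.trans (ℕP.*-identityˡ _)
      (≡.trans (opposite-bits (lt-opposite (i≢j ∘ p-injective)) (lt-opposite (i≢j ∘ ≡.sym ∘ q-injective)))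
               (≡.sym (≡.cong₂ (λ x y → 2 * x + y) (ℕP.*-identityˡ (lt (p i) (p j) * lt (q j) (q i)))
                                                    (ℕP.*-identityˡ (lt (p j) (p i))))))
    where i≢j = FinP.<⇒≢ i<j

  ∑∑-cong : ∀ {f g : Fin n → Fin n → ℕ} → (∀ i j → f i j ≡ g i j) → ∑∑ f ≡ ∑∑ g
  ∑∑-cong {n} f≗g = ∑-cong (allFin n) (λ i → ∑-cong (allFin n) (f≗g i))

  ∑∑-distrib-+ : ∀ (f g : Fin n → Fin n → ℕ) → ∑∑ (λ i j → f i j + g i j) ≡ ∑∑ f + ∑∑ g
  ∑∑-distrib-+ {n} f g = ≡.trans (∑-cong (allFin n) (λ i → ∑-distrib-+ (allFin n) (f i) (g i)))
                                 (∑-distrib-+ (allFin n) _ _)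

  ∑∑-double : ∀ (f : Fin n → Fin n → ℕ) → ∑∑ (λ i j → 2 * f i j) ≡ 2 * ∑∑ f
  ∑∑-double {n} f =
    ≡.sym (≡.trans (*-distribˡ-∑ 2 (allFin n) _) (∑-cong (allFin n) (λ i → *-distribˡ-∑ 2 (allFin n) (f i))))

  ∑∑-symmetrise : ∀ (f : Fin n → Fin n → ℕ) →
                  ∑∑ f ≡ ∑∑ (λ i j → lt i j * (f i j + f j i)) + ∑[ i ∈ allFin n ] f i i
  ∑∑-symmetrise {n} f = begin
    ∑∑ f
      ≡⟨ ∑∑-cong (λ i j → ≡.sym (≡.trans (≡.cong (_* f i j) (lt-trichotomy i j)) (ℕP.*-identityˡ _))) ⟩
    ∑∑ (λ i j → (lt i j + lt j i + δ i j) * f i j)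
      ≡⟨ ∑∑-cong (λ i j → distrib₃ (lt i j) (lt j i) (δ i j) (f i j)) ⟩
    ∑∑ (λ i j → lt i j * f i j + lt j i * f i j + δ i j * f i j)
      ≡⟨ ≡.trans (∑∑-distrib-+ (λ i j → lt i j * f i j + lt j i * f i j) (λ i j → δ i j * f i j))
                 (≡.cong (_+ ∑∑ (λ i j → δ i j * f i j))
                         (∑∑-distrib-+ (λ i j → lt i j * f i j) (λ i j → lt j i * f i j))) ⟩
    ∑∑ (λ i j → lt i j * f i j) + ∑∑ (λ i j → lt j i * f i j) + ∑∑ (λ i j → δ i j * f i j)
      ≡⟨ ≡.cong₂ _+_ (≡.cong (∑∑ (λ i j → lt i j * f i j) +_)
                             (∑-comm (allFin n) (allFin n) (λ i j → lt j i * f i j)))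
                     (∑-cong (allFin n) (λ i → allFin-enumerates n i (f i))) ⟩
    ∑∑ (λ i j → lt i j * f i j) + ∑∑ (λ i j → lt i j * f j i) + ∑[ i ∈ allFin n ] f i i
      ≡⟨ ≡.cong (_+ ∑[ i ∈ allFin n ] f i i)
                (≡.trans (≡.sym (∑∑-distrib-+ (λ i j → lt i j * f i j) (λ i j → lt i j * f j i)))
                         (∑∑-cong (λ i j → ≡.sym (ℕP.*-distribˡ-+ (lt i j) (f i j) (f j i))))) ⟩
    ∑∑ (λ i j → lt i j * (f i j + f j i)) + ∑[ i ∈ allFin n ] f i i ∎
    where
    open ≡.≡-Reasoning
    distrib₃ : ∀ a b d x → (a + b + d) * x ≡ a * x + b * x + d * x
    distrib₃ = solve-∀

  module _ {n : ℕ} (h h⁻ : Fin n → Fin n) (hh⁻ : ∀ i → h (h⁻ i) ≡ i) (h⁻h : ∀ i → h⁻ (h i) ≡ i) where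

    ∑∑-bijection : ∀ (f : Fin n → Fin n → ℕ) → ∑∑ (λ i j → f (h i) (h j)) ≡ ∑∑ f
    ∑∑-bijection f = ≡.trans (∑-cong (allFin n) (λ i → bijection (f (h i))))
                             (bijection (λ i → ∑[ j ∈ allFin n ] f i j))
      where
      bijection : ∀ (g : Fin n → ℕ) → ∑ (allFin n) (g ∘ h) ≡ ∑ (allFin n) g
      bijection = Enumeration.∑-bijection FinP._≟_ {allFin n} (allFin-enumerates n) h h⁻ hh⁻ h⁻h

    -- Pairs {i, j} inverted by both g ∘ h and g, or by neither, are counted twice;
    -- the remaining ones are exactly the inversions of h⁻.
    inversions′-∘ : ∀ (g : Fin n → Fin n) → (∀ {i j} → g i ≡ g j → i ≡ j) →
                    inversions′ (g ∘ h) + inversions′ g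
                      ≡ 2 * ∑∑ (λ i j → lt i j * (lt (h⁻ i) (h⁻ j) * lt (g j) (g i))) + inversions′ h⁻
    inversions′-∘ g g-injective = begin
      inversions′ (g ∘ h) + inversions′ g
        ≡⟨ ≡.cong (_+ inversions′ g) (≡.trans (∑∑-cong reindex) (∑∑-bijection C)) ⟩
      ∑∑ C + inversions′ g
        ≡⟨ ≡.trans (≡.sym (∑∑-distrib-+ C (λ i j → lt i j * lt (g j) (g i))))
                   (∑∑-cong (λ i j → ≡.sym (ℕP.*-distribʳ-+ (lt (g j) (g i)) (lt (h⁻ i) (h⁻ j)) (lt i j)))) ⟩
      ∑∑ f
        ≡⟨ ∑∑-symmetrise f ⟩
      ∑∑ (λ i j → lt i j * (f i j + f j i)) + ∑[ i ∈ allFin n ] f i i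
        ≡⟨ ≡.cong₂ _+_ (∑∑-cong (symmetrised-summand h⁻-injective g-injective))
                       (≡.trans (∑-cong (allFin n) diagonal) (∑-zero (allFin n))) ⟩
      ∑∑ (λ i j → 2 * (lt i j * C i j) + lt i j * lt (h⁻ j) (h⁻ i)) + 0
        ≡⟨ ℕP.+-identityʳ _ ⟩
      ∑∑ (λ i j → 2 * (lt i j * C i j) + lt i j * lt (h⁻ j) (h⁻ i))
        ≡⟨ ≡.trans (∑∑-distrib-+ (λ i j → 2 * (lt i j * C i j)) (λ i j → lt i j * lt (h⁻ j) (h⁻ i)))
                   (≡.cong (_+ inversions′ h⁻) (∑∑-double (λ i j → lt i j * C i j))) ⟩
      2 * ∑∑ (λ i j → lt i j * C i j) + inversions′ h⁻ ∎
      where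
      open ≡.≡-Reasoning
      C f : Fin n → Fin n → ℕ
      C i j = lt (h⁻ i) (h⁻ j) * lt (g j) (g i)
      f i j = (lt (h⁻ i) (h⁻ j) + lt i j) * lt (g j) (g i)

      reindex : ∀ i j → lt i j * lt (g (h j)) (g (h i)) ≡ C (h i) (h j)
      reindex i j = ≡.cong₂ (λ x y → lt x y * lt (g (h j)) (g (h i))) (≡.sym (h⁻h i)) (≡.sym (h⁻h j))

      diagonal : ∀ i → f i i ≡ 0
      diagonal i rewrite lt-irrefl i | lt-irrefl (h⁻ i) = ≡.refl

      h⁻-injective : ∀ {i j} → h⁻ i ≡ h⁻ j → i ≡ j
      h⁻-injective {i} {j} e = ≡.trans (≡.sym (hh⁻ i)) (≡.trans (≡.cong h e) (hh⁻ j))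

  -- Reindexing j ↦ τ j turns the summand into a function symmetric in i and j,
  -- so only the diagonal i = j can contribute an odd amount.
  inversions′-involution : ∀ (τ : Fin n → Fin n) → (∀ i → τ (τ i) ≡ i) →
                    inversions′ τ ≡ 2 * ∑∑ (λ i j → lt i j * (lt i (τ j) * lt j (τ i))) + ∑[ i ∈ allFin n ] lt i (τ i)
  inversions′-involution {n} τ ττ = begin
    inversions′ τ
      ≡⟨ ∑-cong (allFin n) (λ i → ≡.sym (bijection (λ j → lt i j * lt (τ j) (τ i)))) ⟩
    ∑∑ (λ i j → lt i (τ j) * lt (τ (τ j)) (τ i))
      ≡⟨ ∑∑-cong (λ i j → ≡.cong (λ x → lt i (τ j) * lt x (τ i)) (ττ j)) ⟩
    ∑∑ M
      ≡⟨ ∑∑-symmetrise M ⟩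
    ∑∑ (λ i j → lt i j * (M i j + M j i)) + ∑[ i ∈ allFin n ] M i i
      ≡⟨ ≡.cong₂ _+_ (≡.trans (∑∑-cong (λ i j → ≡.trans (≡.cong (λ x → lt i j * (M i j + x)) (M-symmetric i j))
                                                         (twice (lt i j) (M i j))))
                              (∑∑-double (λ i j → lt i j * M i j)))
                     (∑-cong (allFin n) (λ i → lt-idem i (τ i))) ⟩
    2 * ∑∑ (λ i j → lt i j * M i j) + ∑[ i ∈ allFin n ] lt i (τ i) ∎
    where
    open ≡.≡-Reasoning
    M : Fin n → Fin n → ℕ
    M i j = lt i (τ j) * lt j (τ i)
    M-symmetric : ∀ i j → M j i ≡ M i j
    M-symmetric i j = ℕP.*-comm (lt j (τ i)) (lt i (τ j))
    bijection : ∀ (g : Fin n → ℕ) → ∑ (allFin n) (g ∘ τ) ≡ ∑ (allFin n) g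
    bijection = Enumeration.∑-bijection FinP._≟_ {allFin n} (allFin-enumerates n) τ τ ττ ττ
    twice : ∀ a m → a * (m + m) ≡ 2 * (a * m)
    twice = solve-∀

  ∑-lt-transpose : ∀ {a b : Fin n} → a Fin.< b → ∑[ i ∈ allFin n ] lt i (PC.transpose a b i) ≡ 1
  ∑-lt-transpose {n} {a} {b} a<b =
    ≡.trans (∑-cong (allFin n) (λ i → ≡.trans (cases i (i FinP.≟ a) (i FinP.≟ b)) (≡.sym (ℕP.*-identityʳ _))))
            (allFin-enumerates n a (λ _ → 1))
    where
    cases : ∀ i → Dec (i ≡ a) → Dec (i ≡ b) → lt i (PC.transpose a b i) ≡ δ a i
    cases i (yes ≡.refl) _ rewrite transpose-matchˡ i b | lt-< a<b | dec-true (i FinP.≟ i) ≡.refl = ≡.refl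
    cases i (no  _) (yes ≡.refl) rewrite transpose-matchʳ a i | lt-≮ (FinP.<-asym a<b)
                                       | dec-false (a FinP.≟ i) (FinP.<⇒≢ a<b) = ≡.refl
    cases i (no  i≢a) (no  i≢b) rewrite transpose-miss i≢a i≢b | lt-irrefl i
                                      | dec-false (a FinP.≟ i) (≢-sym i≢a) = ≡.refl

  inversions-transpose-∘ₚ : ∀ {a b : Fin n} → a Fin.< b → ∀ (σ : Permutation′ n) →
                            ∃ λ m → inversions (transpose a b ∘ₚ σ) + inversions σ ≡ suc (m + m)
  inversions-transpose-∘ₚ {n} {a} {b} a<b σ = X + Y , (begin
    inversions (transpose a b ∘ₚ σ) + inversions σ
      ≡⟨ ≡.cong₂ _+_ (inversions≡inversions′ (transpose a b ∘ₚ σ)) (inversions≡inversions′ σ) ⟩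
    inversions′ (g ∘ τ) + inversions′ g
      ≡⟨ inversions′-∘ τ τ τ-involutive τ-involutive g g-injective ⟩
    2 * X + inversions′ τ
      ≡⟨ ≡.cong (2 * X +_) (≡.trans (inversions′-involution τ τ-involutive) (≡.cong (2 * Y +_) (∑-lt-transpose a<b))) ⟩
    2 * X + (2 * Y + 1)
      ≡⟨ arithmetic X Y ⟩
    suc (X + Y + (X + Y)) ∎)
    where
    open ≡.≡-Reasoning
    τ g : Fin n → Fin n
    τ = PC.transpose a b
    g = σ ⟨$⟩ʳ_
    τ-involutive : ∀ i → τ (τ i) ≡ i
    τ-involutive = transpose-involutive a b
    g-injective : ∀ {i j} → g i ≡ g j → i ≡ j
    g-injective {i} {j} e = ≡.trans (≡.sym (inverseˡ σ)) (≡.trans (≡.cong (σ ⟨$⟩ˡ_) e) (inverseˡ σ))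
    X Y : ℕ
    X = ∑∑ (λ i j → lt i j * (lt (τ i) (τ j) * lt (g j) (g i)))
    Y = ∑∑ (λ i j → lt i j * (lt i (τ j) * lt j (τ i)))
    arithmetic : ∀ x y → 2 * x + (2 * y + 1) ≡ suc (x + y + (x + y))
    arithmetic = solve-∀

  %2-differ : ∀ x y m → x + y ≡ suc (m + m) → x % 2 ≢ y % 2
  %2-differ x y m x+y≡ x≡y = contradiction (begin
    0                         ≡⟨ m*n%n≡0 (y % 2) 2 ⟨
    (y % 2 * 2) % 2           ≡⟨ ≡.cong (_% 2) (ℕP.*-comm (y % 2) 2) ⟩
    (2 * (y % 2)) % 2         ≡⟨ ≡.cong (λ r → (r + (y % 2 + 0)) % 2) x≡y ⟨
    (x % 2 + (y % 2 + 0)) % 2 ≡⟨ ≡.cong (λ r → (x % 2 + r) % 2) (ℕP.+-identityʳ _) ⟩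
    (x % 2 + y % 2) % 2       ≡⟨ %-distribˡ-+ x y 2 ⟨
    (x + y) % 2               ≡⟨ ≡.cong (_% 2) (≡.trans x+y≡ (odd m)) ⟩
    (1 + m * 2) % 2           ≡⟨ [m+kn]%n≡m%n 1 m 2 ⟩
    1                         ∎) (λ ())
    where
    open ≡.≡-Reasoning
    odd : ∀ m → suc (m + m) ≡ 1 + m * 2
    odd = solve-∀

  %2≢0⇒≡1 : ∀ m → m % 2 ≢ 0 → m % 2 ≡ 1
  %2≢0⇒≡1 m m%2≢0 with m % 2 | m%n<n m 2
  ... | 0           | _                   = contradiction ≡.refl m%2≢0
  ... | 1           | _                   = ≡.refl
  ... | suc (suc _) | ℕ.s≤s (ℕ.s≤s ())

  transpose-∘ₚ-flips-parity : ∀ {a b : Fin n} → a Fin.< b → ∀ (σ : Permutation′ n) →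
                              inversions (transpose a b ∘ₚ σ) % 2 ≢ inversions σ % 2
  transpose-∘ₚ-flips-parity {a = a} {b} a<b σ =
    let m , odd = inversions-transpose-∘ₚ a<b σ in %2-differ (inversions (transpose a b ∘ₚ σ)) (inversions σ) m odd

  inversions-cong : ∀ {σ τ : Permutation′ n} → σ ≈ₚ τ → inversions σ ≡ inversions τ
  inversions-cong {σ = σ} {τ} σ≈τ =
    ≡.trans (inversions≡inversions′ σ)
            (≡.trans (∑∑-cong (λ i j → ≡.cong₂ (λ x y → lt i j * lt x y) (σ≈τ j) (σ≈τ i)))
                     (≡.sym (inversions≡inversions′ τ)))

module TensorProperties {c ℓ} (F : CommutativeRing c ℓ) (k n : ℕ) where
  open CommutativeRing F
  open Tensor F k n
  open ListSum commutativeSemiring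
  open import Relation.Binary.Reasoning.Setoid setoid
  open import Algebra.Properties.CommutativeSemigroup *-commutativeSemigroup using (x∙yz≈y∙xz; x∙yz≈y∙zx)

  Words : List Word
  Words = allWords k n

  δʷ : Word → Word → Carrier
  δʷ = Enumeration.δ (≡-dec FinP._≟_)

  φ≡δ : ∀ σ w v → φ σ w v ≡ δʷ w (act σ v)
  φ≡δ σ w v with ≡-dec FinP._≟_ w (act σ v)
  ... | yes _ = ≡.refl
  ... | no  _ = ≡.refl

  ∑∑-φ : ∀ σ (X : Mat) → ∑[ w ∈ Words ] ∑[ v ∈ Words ] (φ σ w v * X w v) ≈ ∑[ v ∈ Words ] X (act σ v) v
  ∑∑-φ σ X = begin
    ∑[ w ∈ Words ] ∑[ v ∈ Words ] (φ σ w v * X w v)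
      ≈⟨ ∑-comm Words Words _ ⟩
    ∑[ v ∈ Words ] ∑[ w ∈ Words ] (φ σ w v * X w v)
      ≈⟨ ∑-cong Words (λ v → ∑-cong Words (λ w → *-congʳ (reflexive
           (≡.trans (φ≡δ σ w v) (Enumeration.δ-comm (≡-dec FinP._≟_) w (act σ v)))))) ⟩
    ∑[ v ∈ Words ] ∑[ w ∈ Words ] (δʷ (act σ v) w * X w v)
      ≈⟨ ∑-cong Words (λ v → allWords-enumerates k n (act σ v) (λ w → X w v)) ⟩
    ∑[ v ∈ Words ] X (act σ v) v ∎

  Combination : Set c
  Combination = List (Carrier × Permutation′ n)

  scale : Carrier → Combination → Combination
  scale a = map (λ p → a * proj₁ p , proj₂ p)

  lincomb-++ : ∀ (L L′ : Combination) w v → lincomb (L ++ L′) w v ≈ lincomb L w v + lincomb L′ w v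
  lincomb-++ L L′ w v = ∑-++ L L′ _

  lincomb-scale : ∀ a (L : Combination) w v → lincomb (scale a L) w v ≈ a * lincomb L w v
  lincomb-scale a L w v = begin
    lincomb (scale a L) w v                           ≈⟨ ∑-map _ L _ ⟩
    ∑[ p ∈ L ] ((a * proj₁ p) * φ (proj₂ p) w v)      ≈⟨ ∑-cong L (λ p → *-assoc a _ _) ⟩
    ∑[ p ∈ L ] (a * (proj₁ p * φ (proj₂ p) w v))      ≈⟨ *-distribˡ-∑ a L _ ⟨
    a * lincomb L w v                                 ∎

  lincomb-concatMap : ∀ (g : Carrier × Permutation′ n → Combination) (L : Combination) w v →
                      lincomb (concatMap g L) w v ≈ ∑[ p ∈ L ] lincomb (g p) w v
  lincomb-concatMap g L w v = ∑-concatMap g L _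

  ·-congʳ : ∀ M {N N′} → N ≈ₘ N′ → (M · N) ≈ₘ (M · N′)
  ·-congʳ M N≈N′ w v = ∑-cong Words (λ u → *-congˡ (N≈N′ u v))

  ·-congˡ : ∀ {M M′} N → M ≈ₘ M′ → (M · N) ≈ₘ (M′ · N)
  ·-congˡ N M≈M′ w v = ∑-cong Words (λ u → *-congʳ (M≈M′ w u))

  ·-lincombʳ : ∀ M (L : Combination) w v → (M · lincomb L) w v ≈ ∑[ p ∈ L ] (proj₁ p * (M · φ (proj₂ p)) w v)
  ·-lincombʳ M L w v = begin
    ∑[ u ∈ Words ] (M w u * lincomb L u v)
      ≈⟨ ∑-cong Words (λ u → *-distribˡ-∑ (M w u) L _) ⟩
    ∑[ u ∈ Words ] ∑[ p ∈ L ] (M w u * (proj₁ p * φ (proj₂ p) u v))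
      ≈⟨ ∑-comm Words L _ ⟩
    ∑[ p ∈ L ] ∑[ u ∈ Words ] (M w u * (proj₁ p * φ (proj₂ p) u v))
      ≈⟨ ∑-cong L (λ p → ∑-cong Words (λ u → x∙yz≈y∙xz _ _ _)) ⟩
    ∑[ p ∈ L ] ∑[ u ∈ Words ] (proj₁ p * (M w u * φ (proj₂ p) u v))
      ≈⟨ ∑-cong L (λ p → *-distribˡ-∑ (proj₁ p) Words _) ⟨
    ∑[ p ∈ L ] (proj₁ p * (M · φ (proj₂ p)) w v) ∎

  ·-lincombˡ : ∀ (L : Combination) M w v → (lincomb L · M) w v ≈ ∑[ p ∈ L ] (proj₁ p * (φ (proj₂ p) · M) w v)
  ·-lincombˡ L M w v = begin
    ∑[ u ∈ Words ] (lincomb L w u * M u v)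
      ≈⟨ ∑-cong Words (λ u → trans (*-comm _ _) (*-distribˡ-∑ (M u v) L _)) ⟩
    ∑[ u ∈ Words ] ∑[ p ∈ L ] (M u v * (proj₁ p * φ (proj₂ p) w u))
      ≈⟨ ∑-comm Words L _ ⟩
    ∑[ p ∈ L ] ∑[ u ∈ Words ] (M u v * (proj₁ p * φ (proj₂ p) w u))
      ≈⟨ ∑-cong L (λ p → ∑-cong Words (λ u → x∙yz≈y∙zx _ _ _)) ⟩
    ∑[ p ∈ L ] ∑[ u ∈ Words ] (proj₁ p * (φ (proj₂ p) w u * M u v))
      ≈⟨ ∑-cong L (λ p → *-distribˡ-∑ (proj₁ p) Words _) ⟨
    ∑[ p ∈ L ] (proj₁ p * (φ (proj₂ p) · M) w v) ∎

  commutes-lincomb : ∀ M (L : Combination) → All (λ p → (M · φ (proj₂ p)) ≈ₘ (φ (proj₂ p) · M)) L →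
                     (M · lincomb L) ≈ₘ (lincomb L · M)
  commutes-lincomb M L comm w v = begin
    (M · lincomb L) w v                          ≈⟨ ·-lincombʳ M L w v ⟩
    ∑[ p ∈ L ] (proj₁ p * (M · φ (proj₂ p)) w v) ≈⟨ ∑-cong-All (All.map (λ Mφ≈φM → *-congˡ (Mφ≈φM w v)) comm) ⟩
    ∑[ p ∈ L ] (proj₁ p * (φ (proj₂ p) · M) w v) ≈⟨ ·-lincombˡ L M w v ⟨
    (lincomb L · M) w v                          ∎

module IntegerLemmas where
  open import Data.Integer using (-_; _+_; _*_; _≤_; +≤+)
  open import Data.Integer.Tactic.RingSolver using (solve-∀)
  open ListSum ℤP.+-*-commutativeSemiring

  square-nonneg : ∀ x → 0ℤ ≤ x * x
  square-nonneg (ℤ.+ m)    = ≡.subst (0ℤ ≤_) (≡.sym (ℤP.+◃n≡+n (m ℕ.* m))) (+≤+ ℕ.z≤n)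
  square-nonneg ℤ.-[1+ m ] = +≤+ ℕ.z≤n

  nonneg-+≡0 : ∀ {a b} → 0ℤ ≤ a → 0ℤ ≤ b → a + b ≡ 0ℤ → a ≡ 0ℤ
  nonneg-+≡0 {a} {b} 0≤a 0≤b a+b≡0 =
    ℤP.≤-antisym (≡.subst (a ≤_) a+b≡0 (≡.subst (_≤ a + b) (ℤP.+-identityʳ a) (ℤP.+-mono-≤ (ℤP.≤-refl {a}) 0≤b)))
                 0≤a

  ∑-nonneg : ∀ {a} {A : Set a} (xs : List A) {f : A → ℤ} → (∀ x → 0ℤ ≤ f x) → 0ℤ ≤ ∑ xs f
  ∑-nonneg []       f≥0 = ℤP.≤-refl
  ∑-nonneg (x ∷ xs) f≥0 = ℤP.+-mono-≤ (f≥0 x) (∑-nonneg xs f≥0)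

  ∑-nonneg≡0 : ∀ {a} {A : Set a} (xs : List A) {f : A → ℤ} → (∀ x → 0ℤ ≤ f x) → ∑ xs f ≡ 0ℤ →
               All (λ x → f x ≡ 0ℤ) xs
  ∑-nonneg≡0 []       f≥0 ∑≡0 = []
  ∑-nonneg≡0 (x ∷ xs) {f} f≥0 ∑≡0 =
      nonneg-+≡0 (f≥0 x) (∑-nonneg xs f≥0) ∑≡0
    ∷ ∑-nonneg≡0 xs f≥0 (nonneg-+≡0 (∑-nonneg xs f≥0) (f≥0 x) (≡.trans (ℤP.+-comm _ (f x)) ∑≡0))

  square≡0 : ∀ x → x * x ≡ 0ℤ → x ≡ 0ℤ
  square≡0 x x²≡0 = [ id , id ]′ (ℤP.i*j≡0⇒i≡0∨j≡0 x x²≡0)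

  *-cancelˡ-≢0 : ∀ {a x} → a ≢ 0ℤ → a * x ≡ 0ℤ → x ≡ 0ℤ
  *-cancelˡ-≢0 {a} a≢0 ax≡0 = [ (λ a≡0 → contradiction a≡0 a≢0) , id ]′ (ℤP.i*j≡0⇒i≡0∨j≡0 a ax≡0)

  *-≢0 : ∀ {a b} → a ≢ 0ℤ → b ≢ 0ℤ → a * b ≢ 0ℤ
  *-≢0 {a} a≢0 b≢0 ab≡0 = [ a≢0 , b≢0 ]′ (ℤP.i*j≡0⇒i≡0∨j≡0 a ab≡0)

  self-negating : ∀ {x} → x ≡ - x → x ≡ 0ℤ
  self-negating {x} x≡-x = ℤP.*-cancelˡ-≡ (ℤ.+ 2) x 0ℤ (begin
    ℤ.+ 2 * x    ≡⟨ double x ⟩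
    x + x        ≡⟨ ≡.cong (x +_) x≡-x ⟩
    x + - x      ≡⟨ ℤP.+-inverseʳ x ⟩
    0ℤ           ≡⟨ ℤP.*-zeroʳ (ℤ.+ 2) ⟨
    ℤ.+ 2 * 0ℤ   ∎)
    where
    open ≡.≡-Reasoning
    double : ∀ x → ℤ.+ 2 * x ≡ x + x
    double = solve-∀

module IntegralProjection
  {v p} {V : Set v} (_⊕_ : V → V → V) (_⊙_ : ℤ → V → V) (𝟘 : V) (⟪_,_⟫ : V → V → ℤ)
  (⟪⟫-⊕ : ∀ x y z → ⟪ x ⊕ y , z ⟫ ≡ ⟪ x , z ⟫ ℤ.+ ⟪ y , z ⟫)
  (⟪⟫-⊙ : ∀ a x z → ⟪ a ⊙ x , z ⟫ ≡ a ℤ.* ⟪ x , z ⟫)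
  (⟪⟫-𝟘 : ∀ z → ⟪ 𝟘 , z ⟫ ≡ 0ℤ)
  (⟪⟫-sym : ∀ x y → ⟪ x , y ⟫ ≡ ⟪ y , x ⟫)
  (isotropic⇒null : ∀ x → ⟪ x , x ⟫ ≡ 0ℤ → ∀ y → ⟪ x , y ⟫ ≡ 0ℤ)
  (S : V → Set p) (S-⊕ : ∀ {x y} → S x → S y → S (x ⊕ y)) (S-⊙ : ∀ a {x} → S x → S (a ⊙ x)) (S-𝟘 : S 𝟘)
  where

  open import Data.Integer using (+_; _+_; _*_; -_)
  open import Data.Integer.Tactic.RingSolver using (solve-∀)
  open IntegerLemmas using (*-cancelˡ-≢0; *-≢0)

  _⊥_ : V → List V → Set v
  x ⊥ us = All (λ u → ⟪ x , u ⟫ ≡ 0ℤ) us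

  record Projection (us : List V) (y : V) : Set (v ⊔ p) where
    field
      multiplier      : ℤ
      multiplier≢0    : multiplier ≢ 0ℤ
      correction      : V
      correction∈S    : S correction
      correction∈span : ∀ r → r ⊥ us → ⟪ correction , r ⟫ ≡ 0ℤ
      residual⊥       : ((multiplier ⊙ y) ⊕ correction) ⊥ us

  ⟪⟫-combination : ∀ a x b z r → ⟪ (a ⊙ x) ⊕ (b ⊙ z) , r ⟫ ≡ a * ⟪ x , r ⟫ + b * ⟪ z , r ⟫
  ⟪⟫-combination a x b z r = ≡.trans (⟪⟫-⊕ _ _ r) (≡.cong₂ _+_ (⟪⟫-⊙ a x r) (⟪⟫-⊙ b z r))

  module Step {u us} (u∈S : S u) {y} (P : Projection us y) (Q : Projection us u) where
    open Projection P using () renaming (multiplier to c; multiplier≢0 to c≢0; correction to g;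
                                         correction∈S to g∈S; correction∈span to g∈span; residual⊥ to y′⊥)
    open Projection Q using () renaming (multiplier to d; multiplier≢0 to d≢0; correction to h;
                                         correction∈S to h∈S; correction∈span to h∈span; residual⊥ to u′⊥)
    open ≡.≡-Reasoning

    y′ u′ : V
    y′ = (c ⊙ y) ⊕ g
    u′ = (d ⊙ u) ⊕ h

    ⟪y′,z⟫ : ∀ z → ⟪ y′ , z ⟫ ≡ c * ⟪ y , z ⟫ + ⟪ g , z ⟫
    ⟪y′,z⟫ z = ≡.trans (⟪⟫-⊕ (c ⊙ y) g z) (≡.cong (_+ ⟪ g , z ⟫) (⟪⟫-⊙ c y z))

    ⟪u′,r⟫ : ∀ r → r ⊥ us → ⟪ u′ , r ⟫ ≡ d * ⟪ r , u ⟫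
    ⟪u′,r⟫ r r⊥ = begin
      ⟪ u′ , r ⟫                  ≡⟨ ⟪⟫-⊕ (d ⊙ u) h r ⟩
      ⟪ d ⊙ u , r ⟫ + ⟪ h , r ⟫   ≡⟨ ≡.cong₂ _+_ (⟪⟫-⊙ d u r) (h∈span r r⊥) ⟩
      d * ⟪ u , r ⟫ + 0ℤ          ≡⟨ ℤP.+-identityʳ _ ⟩
      d * ⟪ u , r ⟫               ≡⟨ ≡.cong (d *_) (⟪⟫-sym u r) ⟩
      d * ⟪ r , u ⟫               ∎

    ⊥u′⇒⊥u : ∀ r → r ⊥ us → ⟪ u′ , r ⟫ ≡ 0ℤ → ⟪ r , u ⟫ ≡ 0ℤ
    ⊥u′⇒⊥u r r⊥ u′r≡0 = *-cancelˡ-≢0 d≢0 (≡.trans (≡.sym (⟪u′,r⟫ r r⊥)) u′r≡0)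

    when-null : ⟪ u′ , u′ ⟫ ≡ 0ℤ → Projection (u ∷ us) y
    when-null u′null = record
      { multiplier = c ; multiplier≢0 = c≢0 ; correction = g ; correction∈S = g∈S
      ; correction∈span = λ { r (_ ∷ r⊥) → g∈span r r⊥ }
      ; residual⊥ = ⊥u′⇒⊥u y′ y′⊥ (isotropic⇒null u′ u′null y′) ∷ y′⊥
      }

    -- y″ = N y′ − a u′, with N = ⟪u′,u′⟫ and a = ⟪y′,u′⟫, is the residual of y′ after projecting out u′.
    when-nonnull : ⟪ u′ , u′ ⟫ ≢ 0ℤ → Projection (u ∷ us) y
    when-nonnull N≢0 = record
      { multiplier = N * c ; multiplier≢0 = *-≢0 N≢0 c≢0
      ; correction = (N ⊙ g) ⊕ ((- a) ⊙ u′)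
      ; correction∈S = S-⊕ (S-⊙ N g∈S) (S-⊙ (- a) (S-⊕ (S-⊙ d u∈S) h∈S))
      ; correction∈span = correction″∈span
      ; residual⊥ = ⊥u′⇒⊥u y″ y″⊥us (≡.trans (⟪⟫-sym u′ y″) (≡.trans (⟪y″,z⟫ u′) (cancels N a)))
                  ∷ y″⊥us
      }
      where
      N a : ℤ
      N = ⟪ u′ , u′ ⟫
      a = ⟪ y′ , u′ ⟫
      y″ : V
      y″ = ((N * c) ⊙ y) ⊕ ((N ⊙ g) ⊕ ((- a) ⊙ u′))

      regroup : ∀ N c Y G a U → (N * c) * Y + (N * G + (- a) * U) ≡ N * (c * Y + G) + (- a) * U
      regroup = solve-∀
      cancels : ∀ N a → N * a + (- a) * N ≡ 0ℤ
      cancels = solve-∀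
      kills : ∀ N a → N * 0ℤ + (- a) * 0ℤ ≡ 0ℤ
      kills = solve-∀

      ⟪y″,z⟫ : ∀ z → ⟪ y″ , z ⟫ ≡ N * ⟪ y′ , z ⟫ + (- a) * ⟪ u′ , z ⟫
      ⟪y″,z⟫ z = begin
        ⟪ y″ , z ⟫
          ≡⟨ ⟪⟫-⊕ ((N * c) ⊙ y) ((N ⊙ g) ⊕ ((- a) ⊙ u′)) z ⟩
        ⟪ (N * c) ⊙ y , z ⟫ + ⟪ (N ⊙ g) ⊕ ((- a) ⊙ u′) , z ⟫
          ≡⟨ ≡.cong₂ _+_ (⟪⟫-⊙ (N * c) y z) (⟪⟫-combination N g (- a) u′ z) ⟩
        (N * c) * ⟪ y , z ⟫ + (N * ⟪ g , z ⟫ + (- a) * ⟪ u′ , z ⟫)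
          ≡⟨ regroup N c ⟪ y , z ⟫ ⟪ g , z ⟫ a ⟪ u′ , z ⟫ ⟩
        N * (c * ⟪ y , z ⟫ + ⟪ g , z ⟫) + (- a) * ⟪ u′ , z ⟫
          ≡⟨ ≡.cong (λ t → N * t + (- a) * ⟪ u′ , z ⟫) (⟪y′,z⟫ z) ⟨
        N * ⟪ y′ , z ⟫ + (- a) * ⟪ u′ , z ⟫ ∎

      y″⊥us : y″ ⊥ us
      y″⊥us = All.zipWith (λ { (y′z≡0 , u′z≡0) →
                ≡.trans (⟪y″,z⟫ _) (≡.trans (≡.cong₂ (λ s t → N * s + (- a) * t) y′z≡0 u′z≡0) (kills N a)) })
                          (y′⊥ , u′⊥)

      correction″∈span : ∀ r → r ⊥ (u ∷ us) → ⟪ (N ⊙ g) ⊕ ((- a) ⊙ u′) , r ⟫ ≡ 0ℤ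
      correction″∈span r (ru≡0 ∷ r⊥) = begin
        ⟪ (N ⊙ g) ⊕ ((- a) ⊙ u′) , r ⟫     ≡⟨ ⟪⟫-combination N g (- a) u′ r ⟩
        N * ⟪ g , r ⟫ + (- a) * ⟪ u′ , r ⟫  ≡⟨ ≡.cong₂ (λ s t → N * s + (- a) * t) (g∈span r r⊥) (⟪u′,r⟫ r r⊥) ⟩
        N * 0ℤ + (- a) * (d * ⟪ r , u ⟫)    ≡⟨ ≡.cong (λ t → N * 0ℤ + (- a) * (d * t)) ru≡0 ⟩
        N * 0ℤ + (- a) * (d * 0ℤ)           ≡⟨ ≡.cong (λ t → N * 0ℤ + (- a) * t) (ℤP.*-zeroʳ d) ⟩
        N * 0ℤ + (- a) * 0ℤ                 ≡⟨ kills N a ⟩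
        0ℤ                                  ∎

    extend : Projection (u ∷ us) y
    extend with ⟪ u′ , u′ ⟫ ℤP.≟ 0ℤ
    ... | yes u′null = when-null u′null
    ... | no  N≢0    = when-nonnull N≢0

  project : ∀ us → All S us → ∀ y → Projection us y
  project []       []             y = record
    { multiplier = + 1 ; multiplier≢0 = λ () ; correction = 𝟘 ; correction∈S = S-𝟘
    ; correction∈span = λ r _ → ⟪⟫-𝟘 r ; residual⊥ = []
    }
  project (u ∷ us) (u∈S ∷ us⊆S) y = Step.extend u∈S (project us us⊆S y) (project us us⊆S u)

parity-sign : ℕ → ℤ
parity-sign m = if does (m ℕ.% 2 ℕ.≟ 0) then ℤ.+ 1 else ℤ.-[1+ 0 ]

sign : ∀ {n} → Permutation′ n → ℤ
sign σ = parity-sign (inversions σ)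

module _ {n : ℕ} where

  even? : ∀ (σ : Permutation′ n) → Dec (IsEven σ)
  even? σ = inversions σ ℕ.% 2 ℕ.≟ 0

  IsEven-cong : ∀ {σ τ : Permutation′ n} → σ ≈ₚ τ → IsEven σ → IsEven τ
  IsEven-cong {σ} {τ} σ≈τ = ≡.subst (λ m → m ℕ.% 2 ≡ 0) (Parity.inversions-cong {σ = σ} {τ} σ≈τ)

  sign-cong : ∀ {σ τ : Permutation′ n} → σ ≈ₚ τ → sign σ ≡ sign τ
  sign-cong {σ} {τ} σ≈τ = ≡.cong parity-sign (Parity.inversions-cong {σ = σ} {τ} σ≈τ)

  sign-even : ∀ {σ : Permutation′ n} → IsEven σ → sign σ ≡ ℤ.+ 1
  sign-even {σ} even rewrite dec-true (inversions σ ℕ.% 2 ℕ.≟ 0) even = ≡.refl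

  sign-odd : ∀ {σ : Permutation′ n} → ¬ IsEven σ → sign σ ≡ ℤ.-[1+ 0 ]
  sign-odd {σ} odd rewrite dec-false (inversions σ ℕ.% 2 ℕ.≟ 0) odd = ≡.refl

  sign-transpose-∘ₚ : ∀ {a b : Fin n} → a Fin.< b → ∀ σ → sign (transpose a b ∘ₚ σ) ≡ ℤ.- sign σ
  sign-transpose-∘ₚ {a} {b} a<b σ = cases (even? (transpose a b ∘ₚ σ)) (even? σ)
    where
    differ : inversions (transpose a b ∘ₚ σ) ℕ.% 2 ≢ inversions σ ℕ.% 2
    differ = Parity.transpose-∘ₚ-flips-parity a<b σ
    cases : ∀ (d : Dec (IsEven (transpose a b ∘ₚ σ))) (e : Dec (IsEven σ)) →
            (if does d then ℤ.+ 1 else ℤ.-[1+ 0 ]) ≡ ℤ.- (if does e then ℤ.+ 1 else ℤ.-[1+ 0 ])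
    cases (yes even₁) (yes even₂) = contradiction (≡.trans even₁ (≡.sym even₂)) differ
    cases (yes _)     (no  _)     = ≡.refl
    cases (no  _)     (yes _)     = ≡.refl
    cases (no  odd₁)  (no  odd₂)  = contradiction (≡.trans (Parity.%2≢0⇒≡1 (inversions (transpose a b ∘ₚ σ)) odd₁)
                                                           (≡.sym (Parity.%2≢0⇒≡1 (inversions σ) odd₂))) differ

module _ {n : ℕ} where
  open import Data.Integer using (-_; _*_)
  open ListSum ℤP.+-*-commutativeSemiring
  open PermutationSum ℤP.+-*-commutativeSemiring
  open IntegerLemmas using (self-negating)

  -- Reindexing by σ ↦ transpose a b ∘ₚ σ shows that the sum equals its own negative.
  ∑-sign-annihilates : ∀ {a b : Fin n} → a Fin.< b → ∀ (f : Permutation′ n → ℤ) →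
                       (∀ {σ τ} → σ ≈ₚ τ → f σ ≡ f τ) →
                       (∀ σ → f (transpose a b ∘ₚ σ) ≡ f σ) → ∑[ σ ∈ permutations n ] (sign σ * f σ) ≡ 0ℤ
  ∑-sign-annihilates {a} {b} a<b f f-cong f-invariant = self-negating (begin
    ∑[ σ ∈ permutations n ] (sign σ * f σ)
      ≡⟨ ∑-permutations-∘ₚ t (λ σ → sign σ * f σ)
                             (λ {σ} {τ} σ≈τ → ≡.cong₂ _*_ (sign-cong {σ = σ} {τ} σ≈τ) (f-cong σ≈τ)) ⟨
    ∑[ σ ∈ permutations n ] (sign (t ∘ₚ σ) * f (t ∘ₚ σ))
      ≡⟨ ∑-cong (permutations n) (λ σ → ≡.trans (≡.cong₂ _*_ (sign-transpose-∘ₚ a<b σ) (f-invariant σ))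
                                                (≡.trans (≡.sym (ℤP.neg-distribˡ-* (sign σ) (f σ)))
                                                         (≡.sym (ℤP.-1*i≡-i _)))) ⟩
    ∑[ σ ∈ permutations n ] (ℤ.-1ℤ * (sign σ * f σ))
      ≡⟨ *-distribˡ-∑ ℤ.-1ℤ (permutations n) _ ⟨
    ℤ.-1ℤ * ∑[ σ ∈ permutations n ] (sign σ * f σ)
      ≡⟨ ℤP.-1*i≡-i _ ⟩
    - ∑[ σ ∈ permutations n ] (sign σ * f σ) ∎)
    where
    open ≡.≡-Reasoning
    t : Permutation′ n
    t = transpose a b

module IntegralRelation (k n : ℕ) where
  open import Data.Integer using (-_; _+_; _*_)
  open Tensor ℤP.+-*-commutativeRing k n
  open TensorProperties ℤP.+-*-commutativeRing k n
  open ListSum ℤP.+-*-commutativeSemiring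
  open IntegerLemmas
  open ≡.≡-Reasoning

  ⟨_,_⟩ : Mat → Mat → ℤ
  ⟨ X , Y ⟩ = ∑[ w ∈ Words ] ∑[ v ∈ Words ] (X w v * Y w v)

  ⟨⟩-congˡ : ∀ {X X′} Y → X ≈ₘ X′ → ⟨ X , Y ⟩ ≡ ⟨ X′ , Y ⟩
  ⟨⟩-congˡ Y X≈X′ = ∑-cong Words (λ w → ∑-cong Words (λ v → ≡.cong (_* Y w v) (X≈X′ w v)))

  ⟨⟩-sym : ∀ X Y → ⟨ X , Y ⟩ ≡ ⟨ Y , X ⟩
  ⟨⟩-sym X Y = ∑-cong Words (λ w → ∑-cong Words (λ v → ℤP.*-comm (X w v) (Y w v)))

  ⟨⟩-+ˡ : ∀ X Y Z → ⟨ (λ w v → X w v + Y w v) , Z ⟩ ≡ ⟨ X , Z ⟩ + ⟨ Y , Z ⟩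
  ⟨⟩-+ˡ X Y Z = ≡.trans (∑-cong Words (λ w → ≡.trans (∑-cong Words (λ v → ℤP.*-distribʳ-+ (Z w v) (X w v) (Y w v)))
                                                      (∑-distrib-+ Words _ _)))
                        (∑-distrib-+ Words _ _)

  ⟨⟩-*ˡ : ∀ a X Z → ⟨ (λ w v → a * X w v) , Z ⟩ ≡ a * ⟨ X , Z ⟩
  ⟨⟩-*ˡ a X Z = ≡.sym (≡.trans (*-distribˡ-∑ a Words _) (∑-cong Words (λ w →
                  ≡.trans (*-distribˡ-∑ a Words _) (∑-cong Words (λ v → ≡.sym (ℤP.*-assoc a (X w v) (Z w v)))))))

  ⟨0,⟩ : ∀ Z → ⟨ (λ _ _ → 0ℤ) , Z ⟩ ≡ 0ℤ
  ⟨0,⟩ Z = ≡.trans (∑-cong Words (λ w → ∑-zero Words)) (∑-zero Words)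

  ⟨⟩-self≡0 : ∀ X → ⟨ X , X ⟩ ≡ 0ℤ → X ≈ₘ (λ _ _ → 0ℤ)
  ⟨⟩-self≡0 X ⟨X,X⟩≡0 w v =
    square≡0 (X w v) (All.lookup (∑-nonneg≡0 Words (λ v → square-nonneg (X w v)) row≡0) (∈-allWords v))
    where
    row≡0 : ∑[ v ∈ Words ] (X w v * X w v) ≡ 0ℤ
    row≡0 = All.lookup (∑-nonneg≡0 Words (λ w → ∑-nonneg Words (λ v → square-nonneg (X w v))) ⟨X,X⟩≡0)
                       (∈-allWords w)

  ⟨lincomb,⟩ : ∀ (L : Combination) Y → ⟨ lincomb L , Y ⟩ ≡ ∑[ p ∈ L ] (proj₁ p * ⟨ φ (proj₂ p) , Y ⟩)
  ⟨lincomb,⟩ []            Y = ⟨0,⟩ Y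
  ⟨lincomb,⟩ ((a , σ) ∷ L) Y = ≡.trans (⟨⟩-+ˡ (λ w v → a * φ σ w v) (lincomb L) Y)
                                       (≡.cong₂ _+_ (⟨⟩-*ˡ a (φ σ) Y) (⟨lincomb,⟩ L Y))

  ⟨φ,⟩ : ∀ σ X → ⟨ φ σ , X ⟩ ≡ ∑[ v ∈ Words ] X (act σ v) v
  ⟨φ,⟩ = ∑∑-φ

  ⟨φ,⟩-cong : ∀ {σ τ} X → σ ≈ₚ τ → ⟨ φ σ , X ⟩ ≡ ⟨ φ τ , X ⟩
  ⟨φ,⟩-cong {σ} {τ} X σ≈τ =
    ≡.trans (⟨φ,⟩ σ X) (≡.trans (∑-cong Words (λ v → ≡.cong (λ u → X u v) (permute-cong {σ = σ} {τ} σ≈τ v)))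
                                (≡.sym (⟨φ,⟩ τ X)))

  module _ (k*k<n : k ℕ.* k ℕ.< n) where

    -- Since k² < n, two positions i < j carry the same pair of letters (wᵢ, vᵢ).
    stabilising-transposition : ∀ (w v : Word) →
                                ∃₂ λ a b → a Fin.< b × act (transpose a b) w ≡ w × act (transpose a b) v ≡ v
    stabilising-transposition w v =
      let a , b , a<b , same = FinP.pigeonhole k*k<n (λ i → Fin.combine (Vec.lookup w i) (Vec.lookup v i))
          wₐ≡w_b , vₐ≡v_b = FinP.combine-injective _ _ _ _ same
      in  a , b , a<b , permute-transpose w wₐ≡w_b , permute-transpose v vₐ≡v_b

    ∑-sign-square : ∀ X → ∑[ σ ∈ permutations n ] (sign σ * (⟨ φ σ , X ⟩ * ⟨ φ σ , X ⟩)) ≡ 0ℤ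
    ∑-sign-square X = begin
      ∑[ σ ∈ permutations n ] (sign σ * (⟨ φ σ , X ⟩ * ⟨ φ σ , X ⟩))
        ≡⟨ ∑-cong (permutations n) (λ σ → ≡.cong (sign σ *_) (≡.trans (≡.cong₂ _*_ (⟨φ,⟩ σ X) (⟨φ,⟩ σ X))
                                                                      (∑-*-∑ Words Words _ _))) ⟩
      ∑[ σ ∈ permutations n ] (sign σ * ∑[ v ∈ Words ] ∑[ v′ ∈ Words ] F v v′ σ)
        ≡⟨ ∑-cong (permutations n) (λ σ → ≡.trans (*-distribˡ-∑ (sign σ) Words _)
                                                  (∑-cong Words (λ v → *-distribˡ-∑ (sign σ) Words _))) ⟩
      ∑[ σ ∈ permutations n ] ∑[ v ∈ Words ] ∑[ v′ ∈ Words ] (sign σ * F v v′ σ)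
        ≡⟨ ≡.trans (∑-comm (permutations n) Words _) (∑-cong Words (λ v → ∑-comm (permutations n) Words _)) ⟩
      ∑[ v ∈ Words ] ∑[ v′ ∈ Words ] ∑[ σ ∈ permutations n ] (sign σ * F v v′ σ)
        ≡⟨ ∑-cong Words (λ v → ≡.trans (∑-cong Words (annihilates v)) (∑-zero Words)) ⟩
      ∑[ v ∈ Words ] 0ℤ
        ≡⟨ ∑-zero Words ⟩
      0ℤ ∎
      where
      F : Word → Word → Permutation′ n → ℤ
      F v v′ σ = X (act σ v) v * X (act σ v′) v′

      annihilates : ∀ v v′ → ∑[ σ ∈ permutations n ] (sign σ * F v v′ σ) ≡ 0ℤ
      annihilates v v′ =
        let a , b , a<b , tv≡v , tv′≡v′ = stabilising-transposition v v′
            fixed : ∀ u → act (transpose a b) u ≡ u → ∀ σ → act (transpose a b ∘ₚ σ) u ≡ act σ u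
            fixed u tu≡u σ = ≡.trans (permute-∘ₚ (transpose a b) σ u) (≡.cong (act σ) tu≡u)
        in  ∑-sign-annihilates a<b (F v v′)
              (λ {σ} {τ} σ≈τ → ≡.cong₂ _*_ (≡.cong (λ u → X u v) (permute-cong {σ = σ} {τ} σ≈τ v))
                                            (≡.cong (λ u → X u v′) (permute-cong {σ = σ} {τ} σ≈τ v′)))
              (λ σ → ≡.cong₂ _*_ (≡.cong (λ u → X u v) (fixed v tv≡v σ))
                                  (≡.cong (λ u → X u v′) (fixed v′ tv′≡v′ σ)))

    -- If X ⊥ φ(Aₙ) then sign σ ⟨φ σ, X⟩² = −⟨φ σ, X⟩² for every σ, so ∑ ⟨φ σ, X⟩² = 0.
    ⊥-even⇒⊥-all : ∀ X → (∀ τ → IsEven τ → ⟨ φ τ , X ⟩ ≡ 0ℤ) → ∀ σ → ⟨ φ σ , X ⟩ ≡ 0ℤ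
    ⊥-even⇒⊥-all X ⊥even σ =
      let ρ , ρ∈ , ρ≈σ = permutations-complete σ
      in  ≡.trans (⟨φ,⟩-cong X (λ i → ≡.sym (ρ≈σ i)))
                  (square≡0 _ (All.lookup (∑-nonneg≡0 (permutations n) (λ τ → square-nonneg (y τ)) ∑y²≡0) ρ∈))
      where
      y : Permutation′ n → ℤ
      y τ = ⟨ φ τ , X ⟩

      signed : ∀ τ → sign τ * (y τ * y τ) ≡ - (y τ * y τ)
      signed τ with even? τ
      ... | yes even = ≡.trans (≡.cong₂ (λ s x → s * (x * x)) (sign-even {σ = τ} even) (⊥even τ even))
                               (≡.cong (λ x → - (x * x)) (≡.sym (⊥even τ even)))
      ... | no  odd  = ≡.trans (≡.cong (_* (y τ * y τ)) (sign-odd {σ = τ} odd)) (ℤP.-1*i≡-i _)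

      ∑y²≡0 : ∑[ τ ∈ permutations n ] (y τ * y τ) ≡ 0ℤ
      ∑y²≡0 = begin
        ∑[ τ ∈ permutations n ] (y τ * y τ)               ≡⟨ ℤP.neg-involutive _ ⟨
        - (- ∑[ τ ∈ permutations n ] (y τ * y τ))         ≡⟨ ≡.cong -_ (ℤP.-1*i≡-i _) ⟨
        - (ℤ.-1ℤ * ∑[ τ ∈ permutations n ] (y τ * y τ))   ≡⟨ ≡.cong -_ (*-distribˡ-∑ ℤ.-1ℤ (permutations n) _) ⟩
        - ∑[ τ ∈ permutations n ] (ℤ.-1ℤ * (y τ * y τ))   ≡⟨ ≡.cong -_ (∑-cong (permutations n) (λ τ →
                                                               ≡.trans (ℤP.-1*i≡-i _) (≡.sym (signed τ)))) ⟩
        - ∑[ τ ∈ permutations n ] (sign τ * (y τ * y τ))  ≡⟨ ≡.cong -_ (∑-sign-square X) ⟩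
        0ℤ                                                ∎

    EvenCombination : Combination → Set
    EvenCombination C = All (λ p → IsEven (proj₂ p)) C

    open IntegralProjection {V = Combination} _++_ scale [] (λ C E → ⟨ lincomb C , lincomb E ⟩)
      (λ C E Z → ≡.trans (⟨⟩-congˡ (lincomb Z) (lincomb-++ C E)) (⟨⟩-+ˡ (lincomb C) (lincomb E) (lincomb Z)))
      (λ a C Z → ≡.trans (⟨⟩-congˡ (lincomb Z) (lincomb-scale a C)) (⟨⟩-*ˡ a (lincomb C) (lincomb Z)))
      (λ Z → ⟨0,⟩ (lincomb Z))
      (λ C E → ⟨⟩-sym (lincomb C) (lincomb E))
      (λ C ⟨C,C⟩≡0 E → ≡.trans (⟨⟩-congˡ (lincomb E) (⟨⟩-self≡0 (lincomb C) ⟨C,C⟩≡0)) (⟨0,⟩ (lincomb E)))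
      EvenCombination AllP.++⁺ (λ _ → AllP.map⁺) []

    evens : List Combination
    evens = map (λ τ → (ℤ.+ 1 , τ) ∷ []) (filter even? (permutations n))

    evens-even : All EvenCombination evens
    evens-even = AllP.map⁺ (All.map (_∷ []) (AllP.all-filter even? (permutations n)))

    φ≈single : ∀ ρ → φ ρ ≈ₘ lincomb ((ℤ.+ 1 , ρ) ∷ [])
    φ≈single ρ w v = ≡.sym (≡.trans (ℤP.+-identityʳ _) (ℤP.*-identityˡ _))

    ⊥evens⇒⊥even : ∀ C → C ⊥ evens → ∀ τ → IsEven τ → ⟨ φ τ , lincomb C ⟩ ≡ 0ℤ
    ⊥evens⇒⊥even C C⊥evens τ even =
      let ρ , ρ∈ , ρ≈τ = permutations-complete τ
          τ≈ρ : τ ≈ₚ ρ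
          τ≈ρ i = ≡.sym (ρ≈τ i)
          ρ∈evens : (ℤ.+ 1 , ρ) ∷ [] ∈ evens
          ρ∈evens = ∈-map⁺ (λ τ → (ℤ.+ 1 , τ) ∷ []) (∈-filter⁺ even? ρ∈ (IsEven-cong {σ = τ} {ρ} τ≈ρ even))
      in  begin
          ⟨ φ τ , lincomb C ⟩                          ≡⟨ ⟨φ,⟩-cong {σ = τ} {ρ} (lincomb C) τ≈ρ ⟩
          ⟨ φ ρ , lincomb C ⟩                          ≡⟨ ⟨⟩-congˡ (lincomb C) (φ≈single ρ) ⟩
          ⟨ lincomb ((ℤ.+ 1 , ρ) ∷ []) , lincomb C ⟩   ≡⟨ ⟨⟩-sym (lincomb ((ℤ.+ 1 , ρ) ∷ [])) (lincomb C) ⟩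
          ⟨ lincomb C , lincomb ((ℤ.+ 1 , ρ) ∷ []) ⟩   ≡⟨ All.lookup C⊥evens ρ∈evens ⟩
          0ℤ                                           ∎

    integral-relation : ∀ σ → ∃₂ λ D L → D ≢ 0ℤ × EvenCombination L × lincomb ((D , σ) ∷ L) ≈ₘ (λ _ _ → 0ℤ)
    integral-relation σ = D , correction , D≢0 , correction∈S , ⟨⟩-self≡0 (lincomb r) ⟨r,r⟩≡0
      where
      open Projection (project evens evens-even ((ℤ.+ 1 , σ) ∷ []))
      D : ℤ
      D = multiplier * ℤ.+ 1
      D≢0 : D ≢ 0ℤ
      D≢0 D≡0 = multiplier≢0 (≡.trans (≡.sym (ℤP.*-identityʳ _)) D≡0)
      r : Combination
      r = (D , σ) ∷ correction
      r⊥φ : ∀ τ → ⟨ φ τ , lincomb r ⟩ ≡ 0ℤ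
      r⊥φ = ⊥-even⇒⊥-all (lincomb r) (⊥evens⇒⊥even r residual⊥)
      ⟨r,r⟩≡0 : ⟨ lincomb r , lincomb r ⟩ ≡ 0ℤ
      ⟨r,r⟩≡0 = begin
        ⟨ lincomb r , lincomb r ⟩
          ≡⟨ ⟨lincomb,⟩ r (lincomb r) ⟩
        ∑[ p ∈ r ] (proj₁ p * ⟨ φ (proj₂ p) , lincomb r ⟩)
          ≡⟨ ∑-cong r (λ p → ≡.trans (≡.cong (proj₁ p *_) (r⊥φ (proj₂ p))) (ℤP.*-zeroʳ (proj₁ p))) ⟩
        ∑[ p ∈ r ] 0ℤ
          ≡⟨ ∑-zero r ⟩
        0ℤ ∎

module Embedding {c ℓ} (F : CommutativeRing c ℓ) where
  open CommutativeRing F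
  open FieldDefs F
  open import Data.Integer using (+_; -[1+_]; _⊖_)
  open import Relation.Binary.Reasoning.Setoid setoid
  open import Algebra.Properties.AbelianGroup +-abelianGroup using (ε⁻¹≈ε; ⁻¹-involutive; ⁻¹-∙-comm)
  open import Algebra.Properties.CommutativeSemigroup +-commutativeSemigroup using (interchange)

  ι : ℤ → Carrier
  ι (+ m)     = m ⋆1
  ι -[1+ m ]  = - (suc m ⋆1)

  ⋆1-+ : ∀ m n → (m ℕ.+ n) ⋆1 ≈ m ⋆1 + n ⋆1
  ⋆1-+ zero    n = sym (+-identityˡ _)
  ⋆1-+ (suc m) n = trans (+-congˡ (⋆1-+ m n)) (sym (+-assoc _ _ _))

  ι-⊖ : ∀ m n → ι (m ⊖ n) ≈ m ⋆1 - n ⋆1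
  ι-⊖ zero    zero    = sym (-‿inverseʳ 0#)
  ι-⊖ zero    (suc n) = sym (+-identityˡ _)
  ι-⊖ (suc m) zero    = sym (trans (+-congˡ ε⁻¹≈ε) (+-identityʳ _))
  ι-⊖ (suc m) (suc n) = begin
    ι (suc m ⊖ suc n)                    ≡⟨ ≡.cong ι (ℤP.[1+m]⊖[1+n]≡m⊖n m n) ⟩
    ι (m ⊖ n)                            ≈⟨ ι-⊖ m n ⟩
    m ⋆1 - n ⋆1                          ≈⟨ +-identityˡ _ ⟨
    0# + (m ⋆1 - n ⋆1)                   ≈⟨ +-congʳ (-‿inverseʳ 1#) ⟨
    (1# - 1#) + (m ⋆1 - n ⋆1)            ≈⟨ interchange _ _ _ _ ⟩
    (1# + m ⋆1) + (- 1# + - n ⋆1)        ≈⟨ +-congˡ (⁻¹-∙-comm _ _) ⟩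
    (1# + m ⋆1) - (1# + n ⋆1)            ∎

  ι-+ : ∀ x y → ι (x ℤ.+ y) ≈ ι x + ι y
  ι-+ (+ m)     (+ n)     = ⋆1-+ m n
  ι-+ (+ m)     -[1+ n ]  = ι-⊖ m (suc n)
  ι-+ -[1+ m ]  (+ n)     = trans (ι-⊖ n (suc m)) (+-comm _ _)
  ι-+ -[1+ m ]  -[1+ n ]  = begin
    - (suc (suc (m ℕ.+ n)) ⋆1)       ≡⟨ ≡.cong (λ s → - (suc s ⋆1)) (ℕP.+-suc m n) ⟨
    - ((suc m ℕ.+ suc n) ⋆1)         ≈⟨ -‿cong (⋆1-+ (suc m) (suc n)) ⟩
    - (suc m ⋆1 + suc n ⋆1)          ≈⟨ ⁻¹-∙-comm _ _ ⟨
    - (suc m ⋆1) + - (suc n ⋆1)      ∎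
    where import Data.Nat.Properties as ℕP

  ι-≉0 : CharZero → ∀ x → x ≢ 0ℤ → ι x ≉ 0#
  ι-≉0 char0 (+ zero)    x≢0 _   = x≢0 ≡.refl
  ι-≉0 char0 (+ suc m)   _   ιx≈0 = char0 m ιx≈0
  ι-≉0 char0 -[1+ m ]    _   ιx≈0 = char0 m (trans (sym (⁻¹-involutive _)) (trans (-‿cong ιx≈0) ε⁻¹≈ε))

  module _ (k n : ℕ) where
    open Tensor F k n
    private module ℤT = Tensor ℤP.+-*-commutativeRing k n

    ι-*φ : ∀ a σ w v → ι (a ℤ.* ℤT.φ σ w v) ≈ ι a * φ σ w v
    ι-*φ a σ w v with ≡-dec FinP._≟_ w (act σ v)
    ... | yes _ = trans (reflexive (≡.cong ι (ℤP.*-identityʳ a))) (sym (*-identityʳ _))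
    ... | no  _ = trans (reflexive (≡.cong ι (ℤP.*-zeroʳ a))) (sym (zeroʳ _))

    ι-lincomb : ∀ (L : List (ℤ × Permutation′ n)) w v →
                ι (ℤT.lincomb L w v) ≈ lincomb (map (λ p → ι (proj₁ p) , proj₂ p) L) w v
    ι-lincomb []            w v = refl
    ι-lincomb ((a , σ) ∷ L) w v =
      trans (ι-+ (a ℤ.* ℤT.φ σ w v) (ℤT.lincomb L w v)) (+-cong (ι-*φ a σ w v) (ι-lincomb L w v))

module Image {c ℓ} (F : CommutativeRing c ℓ) (acf0 : FieldDefs.IsACF0 F) (k n : ℕ) (k*k<n : k ℕ.* k ℕ.< n) where
  open CommutativeRing F
  open FieldDefs F
  open Tensor F k n
  open TensorProperties F k n
  open Embedding F
  open ListSum commutativeSemiring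
  open import Relation.Binary.Reasoning.Setoid setoid
  open import Algebra.Properties.Group +-group using (inverseˡ-unique)
  open import Algebra.Properties.Ring ring using (-‿distribˡ-*; -‿distribʳ-*)

  solve-linear : ∀ {a b x y} → a * b ≈ 1# → a * x + y ≈ 0# → x ≈ (- b) * y
  solve-linear {a} {b} {x} {y} ab≈1 ax+y≈0 = begin
    x             ≈⟨ *-identityˡ x ⟨
    1# * x        ≈⟨ *-congʳ (trans (*-comm b a) ab≈1) ⟨
    (b * a) * x   ≈⟨ *-assoc b a x ⟩
    b * (a * x)   ≈⟨ *-congˡ (inverseˡ-unique _ _ ax+y≈0) ⟩
    b * (- y)     ≈⟨ -‿distribʳ-* b y ⟨
    - (b * y)     ≈⟨ -‿distribˡ-* b y ⟩
    (- b) * y     ∎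

  span-from-relation : ∀ σ D (L : List (ℤ × Permutation′ n)) → D ≢ 0ℤ → All (λ p → IsEven (proj₂ p)) L →
                       (∀ w v → Tensor.lincomb ℤP.+-*-commutativeRing k n ((D , σ) ∷ L) w v ≡ 0ℤ) →
                       InImage IsEven (φ σ)
  span-from-relation σ D L D≢0 L-even relation = scale (- d) L′ , AllP.map⁺ (AllP.map⁺ L-even) , φσ≈
    where
    d⁻¹ : ∃ λ d → ι D * d ≈ 1#
    d⁻¹ = proj₂ (proj₁ acf0) (ι D) (ι-≉0 (proj₁ (proj₂ acf0)) D D≢0)
    d : Carrier
    d = proj₁ d⁻¹
    L′ : Combination
    L′ = map (λ p → ι (proj₁ p) , proj₂ p) L
    φσ≈ : φ σ ≈ₘ lincomb (scale (- d) L′)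
    φσ≈ w v = trans (solve-linear (proj₂ d⁻¹)
                      (trans (sym (ι-lincomb k n ((D , σ) ∷ L) w v)) (reflexive (≡.cong ι (relation w v)))))
                    (sym (lincomb-scale (- d) L′ w v))

  φ∈span-even : ∀ σ → InImage IsEven (φ σ)
  φ∈span-even σ =
    let D , L , D≢0 , L-even , relation = IntegralRelation.integral-relation k n k*k<n σ
    in  span-from-relation σ D L D≢0 L-even relation

  image⊆image-even : ∀ M → InImage AllPerms M → InImage IsEven M
  image⊆image-even M (L , _ , M≈L) = L′ , L′-even , λ w v → trans (M≈L w v) (sym (L′≈L w v))
    where
    span : Permutation′ n → Combination
    span σ = proj₁ (φ∈span-even σ)
    span-even : ∀ σ → All (λ p → IsEven (proj₂ p)) (span σ)
    span-even σ = proj₁ (proj₂ (φ∈span-even σ))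
    expand : Carrier × Permutation′ n → Combination
    expand p = scale (proj₁ p) (span (proj₂ p))
    L′ : Combination
    L′ = concatMap expand L
    L′-even : All (λ p → IsEven (proj₂ p)) L′
    L′-even = AllP.concat⁺ {xss = map expand L}
                (AllP.map⁺ {xs = L} {f = expand} (All.tabulate {xs = L} (λ {p} _ → AllP.map⁺ (span-even (proj₂ p)))))
    L′≈L : lincomb L′ ≈ₘ lincomb L
    L′≈L w v = trans (lincomb-concatMap expand L w v)
                     (∑-cong L (λ p → trans (lincomb-scale (proj₁ p) (span (proj₂ p)) w v)
                                            (*-congˡ (sym (proj₂ (proj₂ (φ∈span-even (proj₂ p))) w v)))))

  commutant-even⊆commutant : ∀ M → Commutes IsEven M → Commutes AllPerms M
  commutant-even⊆commutant M comm σ _ w v = begin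
    (M · φ σ) w v        ≈⟨ ·-congʳ M {φ σ} {lincomb L} φσ≈L w v ⟩
    (M · lincomb L) w v  ≈⟨ commutes-lincomb M L (All.map {P = IsEven ∘ proj₂} (λ {p} → comm (proj₂ p)) L-even) w v ⟩
    (lincomb L · M) w v  ≈⟨ ·-congˡ {φ σ} {lincomb L} M φσ≈L w v ⟨
    (φ σ · M) w v        ∎
    where
    L : Combination
    L = proj₁ (φ∈span-even σ)
    L-even : All (λ p → IsEven (proj₂ p)) L
    L-even = proj₁ (proj₂ (φ∈span-even σ))
    φσ≈L : φ σ ≈ₘ lincomb L
    φσ≈L = proj₂ (proj₂ (φ∈span-even σ))

open import Data.Unit using (tt)
open import Data.Nat using (_*_; _<_)

theorem1 : ∀ {c ℓ} (F : CommutativeRing c ℓ) → FieldDefs.IsACF0 F →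
    (k n : ℕ) → 0 < n → k * k < n →
    ((∀ M → Tensor.InImage F k n IsEven M → Tensor.InImage F k n AllPerms M)
      × (∀ M → Tensor.InImage F k n AllPerms M → Tensor.InImage F k n IsEven M))
    × ((∀ M → Tensor.Commutes F k n IsEven M → Tensor.Commutes F k n AllPerms M)
      × (∀ M → Tensor.Commutes F k n AllPerms M → Tensor.Commutes F k n IsEven M))
theorem1 F acf0 k n _ k*k<n =
    ((λ M (L , even , M≈L) → L , All.map (λ _ → tt) even , M≈L) , image⊆image-even)
  , (commutant-even⊆commutant , (λ M comm σ _ → comm σ tt))
  where open Image F acf0 k n k*k<n
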